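{- Let $n\ge 1$. The tweaking map $T$ (defined in the context) is a bijection from $\mathcal{B}_{n+1}$ onto $\mathcal{IP}^*_{n+1}$, where $\mathcal{B}_{n+1}$ is the set of set partitions $\pi$ of $[n+1]$ such that (i) the block of $\pi$ containing $n+1$ does not consist of consecutive integers, and (ii) every singleton block $\{a\}$ of $\pi$ is straddled by a big block other than the penultimate block (there is a block $B$, not the penultimate one, with $|B|\ge2$ and $\min B<a<\max B$); and $\mathcal{IP}^*_{n+1}$ is the set of indecomposable set partitions of $[n+1]$ with more than one block.
   Context: Blocks of a set partition are ordered by increasing maximum; the last block contains the largest element, the penultimate block is the one with the second largest maximum. A singleton block has one element, a big block more than one. A set partition of $[N]$ is decomposable if there is $k$ with $1\le k<N$ such that $[k]$ is a union of blocks, and indecomposable otherwise; for a decomposable partition, its first component is the set of blocks contained in $[k_0]$, where $k_0$ is the smallest such $k$. The tweaking map $T$ on $\mathcal{B}_{n+1}$: if $\pi$ is indecomposable, $T(\pi)=\pi$; if $\pi$ is decomposable, let $L$ be the block of the first component with the largest maximum, and form $T(\pi)$ by moving all elements of $L$ other than $\max L$ into the penultimate block of $\pi$. -}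

module Defs where

open import Data.Bool using (Bool; true; false; if_then_else_; _∧_; _∨_; not)
open import Data.Nat using (ℕ; zero; suc; _∸_; _<ᵇ_; _≤_; _<_)
open import Data.Fin using (Fin; toℕ; fromℕ) renaming (zero to fzero; suc to fsuc)
open import Data.Fin.Subset using (Subset; _∈_; _⊆_; Nonempty; Empty; _∩_; _∪_; ∁; ⊥; ⁅_⁆; ∣_∣; _-_)
open import Data.Vec using (Vec; []; _∷_; tabulate)
open import Data.List using (List; []; _∷_; length; map; upTo; head; last; filterᵇ)
open import Data.List.Relation.Unary.All using (All)
open import Data.List.Relation.Unary.Any using (Any)
open import Data.List.Relation.Unary.AllPairs using (AllPairs)
open import Data.Maybe using (Maybe; just; nothing; fromMaybe; _>>=_)
open import Data.Product using (Σ; _×_; ∃)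
open import Data.Sum using (_⊎_)
open import Relation.Nullary using (¬_)
open import Relation.Binary.PropositionalEquality using (_≡_; _≢_)
import Data.List.Membership.Propositional as L

-- Conventions: a set partition of [N] = {1,…,N} is a list of blocks, each block a
-- subset of Fin N (index i : Fin N stands for the integer i+1), listed in order of
-- increasing maximum (the paper's convention).

_<F_ : ∀ {N} → Fin N → Fin N → Set
a <F b = toℕ a < toℕ b

_≤F_ : ∀ {N} → Fin N → Fin N → Set
a ≤F b = toℕ a ≤ toℕ b

-- max A < max B (both blocks nonempty): some element of B exceeds every element of A
MaxLt : ∀ {N} → Subset N → Subset N → Set
MaxLt {N} A B = Σ (Fin N) λ b → b ∈ B × (∀ a → a ∈ A → a <F b)

record IsSetPartition {N : ℕ} (π : List (Subset N)) : Set where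
  field
    nonempty : All Nonempty π
    disjoint : AllPairs (λ A B → Empty (A ∩ B)) π
    covers   : ∀ (i : Fin N) → Any (i ∈_) π
    sorted   : AllPairs MaxLt π

-- the segment [k] = {1,…,k}
seg : ∀ {N} → ℕ → Subset N
seg k = tabulate (λ i → toℕ i <ᵇ k)

UnionOfBlocks : ∀ {N} → ℕ → List (Subset N) → Set
UnionOfBlocks k π = All (λ B → B ⊆ seg k ⊎ Empty (B ∩ seg k)) π

Decomposable : ∀ {N} → List (Subset N) → Set
Decomposable {N} π = ∃ λ k → 1 ≤ k × k < N × UnionOfBlocks k π

Indecomposable : ∀ {N} → List (Subset N) → Set
Indecomposable π = ¬ Decomposable π

penult : ∀ {A : Set} → List A → Maybe A
penult []                = nothing
penult (x ∷ [])          = nothing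
penult (x ∷ y ∷ [])      = just x
penult (x ∷ y ∷ z ∷ r)   = penult (y ∷ z ∷ r)

Consecutive : ∀ {N} → Subset N → Set
Consecutive {N} B = ∀ (a c x : Fin N) → a ∈ B → c ∈ B → a ≤F x → x ≤F c → x ∈ B

InB : (n : ℕ) → List (Subset (suc n)) → Set
InB n π =
  IsSetPartition π
  × (∀ B → B L.∈ π → fromℕ n ∈ B → ¬ Consecutive B)
  × (∀ a → ⁅ a ⁆ L.∈ π →
       Σ (Subset (suc n)) λ B → B L.∈ π × (∀ P → penult π ≡ just P → B ≢ P)
         × 2 ≤ ∣ B ∣
         × (Σ (Fin (suc n)) λ x → x ∈ B × x <F a)
         × (Σ (Fin (suc n)) λ y → y ∈ B × a <F y))

InIPstar : (n : ℕ) → List (Subset (suc n)) → Set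
InIPstar n π = IsSetPartition π × Indecomposable π × 2 ≤ length π

maxS : ∀ {n} → Subset n → Maybe (Fin n)
maxS [] = nothing
maxS (b ∷ s) with maxS s
... | just i  = just (fsuc i)
... | nothing = if b then just fzero else nothing

_⊆ᵇ_ : ∀ {n} → Subset n → Subset n → Bool
[] ⊆ᵇ [] = true
(x ∷ xs) ⊆ᵇ (y ∷ ys) = (not x ∨ y) ∧ (xs ⊆ᵇ ys)

emptyᵇ : ∀ {n} → Subset n → Bool
emptyᵇ [] = true
emptyᵇ (x ∷ xs) = not x ∧ emptyᵇ xs

_≡ᵇ_ : ∀ {n} → Subset n → Subset n → Bool
[] ≡ᵇ [] = true
(x ∷ xs) ≡ᵇ (y ∷ ys) = ((x ∧ y) ∨ (not x ∧ not y)) ∧ (xs ≡ᵇ ys)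

allᵇ : ∀ {A : Set} → (A → Bool) → List A → Bool
allᵇ p [] = true
allᵇ p (x ∷ xs) = p x ∧ allᵇ p xs

unionOfBlocksᵇ : ∀ {N} → ℕ → List (Subset N) → Bool
unionOfBlocksᵇ k π = allᵇ (λ B → (B ⊆ᵇ seg k) ∨ emptyᵇ (B ∩ seg k)) π

tweak? : ∀ {N} → List (Subset N) → Maybe (List (Subset N))
tweak? {N} π =
  head (filterᵇ (λ k → unionOfBlocksᵇ k π) (map suc (upTo (N ∸ 1)))) >>= λ k₀ →
  -- L : block of the first component (blocks contained in [k₀]) with largest max
  last (filterᵇ (λ B → B ⊆ᵇ seg k₀) π) >>= λ L →
  maxS L >>= λ m →
  penult π >>= λ P →
  let M = L - m in
  just (map (λ X → (X ∩ ∁ M) ∪ (if X ≡ᵇ P then M else ⊥)) π)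

T : ∀ {N} → List (Subset N) → List (Subset N)
T π = fromMaybe π (tweak? π)

module Submission where

-- For decomposable π let a₀ be the maximum of the first component, L its block,
-- P the penultimate and Z the last block; T π moves L ∖ {a₀} into P, leaving the
-- singleton {a₀}.  A singleton {a} is *straddled* if a big non-penultimate block
-- has elements on both sides of a; condition (ii) of 𝓑 says every singleton is.
--
-- After general tools (reflection of the boolean tests inside T, maxima, the last
-- two blocks of a partition, and `move M C`, which transfers the elements of M
-- into the block C and is undone by moving them back) the proof has two halves:
--  * for decomposable π ∈ 𝓑, T π ∈ 𝓘𝓟*, a₀ is its largest unstraddled singleton
--    and `untweak a₀` recovers π; fixed points of T in 𝓑 have no unstraddled
--    singleton at all, which gives injectivity;
--  * for σ ∈ 𝓘𝓟*, σ itself lies in 𝓑 if all its singletons are straddled, and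
--    otherwise untweaking at its largest unstraddled singleton gives a preimage.

open import Defs
open import Data.Bool using (Bool; true; false; if_then_else_; _∨_)
open import Data.Bool.Properties using (∧-conicalˡ; ∧-conicalʳ; T-≡; ¬-not)
import Data.Bool as Bool
open import Data.Nat using (ℕ; zero; suc; _≤_; _<_; _<ᵇ_; z≤n; s≤s)
open import Data.Nat.Properties as NP
  using (≤-refl; ≤-trans; <-trans; <-irrefl; ≤-<-trans; <-≤-trans; <⇒≤; ≤-antisym; ≰⇒>; _≤?_; _<?_; <⇒<ᵇ; <ᵇ⇒<; ≮⇒≥; m≤n⇒m<n∨m≡n)
open import Data.Fin using (Fin; toℕ; fromℕ; fromℕ<) renaming (zero to fzero; suc to fsuc)
open import Data.Fin.Properties as FP using (toℕ-injective; toℕ<n; toℕ-fromℕ; toℕ-fromℕ<)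
open import Data.Fin.Subset using (Subset; _∈_; _∉_; _⊆_; Nonempty; Empty; _∩_; _∪_; ∁; ⊥; ⁅_⁆; ∣_∣; _-_; _─_)
open import Data.Fin.Subset.Properties
  using (_∈?_; ⊆-antisym; x∈p∩q⁺; x∈p∩q⁻; x∈p∪q⁻; x∈p∪q⁺; x∈∁p⇒x∉p; x∉p⇒x∈∁p; ∉⊥; x∈⁅x⁆; x∈⁅y⁆⇒x≡y; p─q⊆p; x∈p∧x∉q⇒x∈p─q; p⊂q⇒∣p∣<∣q∣; ∣⁅x⁆∣≡1; drop-there)
open import Data.Vec using (_∷_; []; tabulate; here; there)
open import Data.Vec.Properties using (lookup∘tabulate; []=⇒lookup; lookup⇒[]=; ≡-dec)
open import Data.List using (List; []; _∷_; length; map; head; last; filterᵇ; _++_; applyUpTo)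
import Data.List.Properties as LP
open import Data.List.Relation.Unary.All as All using (All; []; _∷_)
open import Data.List.Relation.Unary.All.Properties using () renaming (map⁺ to All-map⁺)
open import Data.List.Relation.Unary.Any as Any using (Any; here; there)
open import Data.List.Relation.Unary.AllPairs using (AllPairs; []; _∷_)
open import Data.Maybe using (Maybe; just; nothing; fromMaybe; _>>=_; maybe)
import Data.Maybe as Maybe
open import Data.Product using (Σ; _×_; _,_; proj₁; proj₂)
open import Data.Sum using (_⊎_; inj₁; inj₂)
open import Data.Empty using (⊥-elim) renaming (⊥ to False)
open import Data.Unit using (tt)
open import Relation.Nullary using (¬_; Dec; yes; no; _×-dec_; ¬?)
open import Relation.Binary.Definitions using (tri<; tri≈; tri>)
open import Relation.Binary.PropositionalEquality using (_≡_; _≢_; refl; sym; trans; cong; cong₂; subst; module ≡-Reasoning)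
open import Function.Bundles using (Equivalence)
import Data.List.Membership.Propositional as L
open import Data.List.Membership.Propositional.Properties using (∈-map⁺; ∈-map⁻; ∈-∃++; ∈-++⁺ʳ)
open import Function using (_∘_)

∈∩∁⁻ : ∀ {N} {p q : Subset N} {x} → x ∈ p ∩ ∁ q → x ∈ p × x ∉ q
∈∩∁⁻ {p = p} {q} h = let xp , xq = x∈p∩q⁻ p (∁ q) h in xp , x∈∁p⇒x∉p xq

∈∩∁⁺ : ∀ {N} {p q : Subset N} {x} → x ∈ p → x ∉ q → x ∈ p ∩ ∁ q
∈∩∁⁺ xp xq = x∈p∩q⁺ (xp , x∉p⇒x∈∁p xq)

∈─⇒∉ : ∀ {N} (p q : Subset N) {x} → x ∈ p ─ q → x ∉ q
∈─⇒∉ (a ∷ p) (true ∷ q)  {fzero}  ()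
∈─⇒∉ (a ∷ p) (false ∷ q) {fzero}  _ ()
∈─⇒∉ (a ∷ p) (b ∷ q)     {fsuc x} h h' = ∈─⇒∉ p q (drop-there h) (drop-there h')

∈-minus⁻ : ∀ {N} {p : Subset N} {x y} → x ∈ p - y → x ∈ p × x ≢ y
∈-minus⁻ {p = p} {x} {y} h =
  p─q⊆p p ⁅ y ⁆ h , λ { refl → ∈─⇒∉ p ⁅ y ⁆ h (x∈⁅x⁆ y) }

∈-minus⁺ : ∀ {N} {p : Subset N} {x y} → x ∈ p → x ≢ y → x ∈ p - y
∈-minus⁺ h x≢y = x∈p∧x∉q⇒x∈p─q h (λ h' → x≢y (x∈⁅y⁆⇒x≡y _ h'))

∈⁅⁆ : ∀ {N} {x a : Fin N} → x ∈ ⁅ a ⁆ → x ≡ a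
∈⁅⁆ {a = a} = x∈⁅y⁆⇒x≡y a

seg⁻ : ∀ {N} k {x : Fin N} → x ∈ seg k → toℕ x < k
seg⁻ k {x} h = <ᵇ⇒< (toℕ x) k (subst Bool.T (sym test) tt)
  where
  test : (toℕ x <ᵇ k) ≡ true
  test = trans (sym (lookup∘tabulate (λ i → toℕ i <ᵇ k) x)) ([]=⇒lookup h)

seg⁺ : ∀ {N} k {x : Fin N} → toℕ x < k → x ∈ seg k
seg⁺ k {x} lt =
  lookup⇒[]= x (seg k) (trans (lookup∘tabulate (λ i → toℕ i <ᵇ k) x) (Equivalence.to T-≡ (<⇒<ᵇ lt)))

two-elements⇒big : ∀ {N} {B : Subset N} {x y} → x ∈ B → y ∈ B → x ≢ y → 2 ≤ ∣ B ∣
two-elements⇒big {B = B} {x} {y} xB yB x≢y =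
  subst (λ t → suc t ≤ ∣ B ∣) (∣⁅x⁆∣≡1 x)
    (p⊂q⇒∣p∣<∣q∣ ((λ h → subst (_∈ B) (sym (∈⁅⁆ h)) xB) , y , yB , λ h → x≢y (sym (∈⁅⁆ h))))

≡ᵇ-refl : ∀ {N} (X : Subset N) → (X ≡ᵇ X) ≡ true
≡ᵇ-refl []          = refl
≡ᵇ-refl (true ∷ X)  = ≡ᵇ-refl X
≡ᵇ-refl (false ∷ X) = ≡ᵇ-refl X

≡ᵇ-sound : ∀ {N} (X Y : Subset N) → (X ≡ᵇ Y) ≡ true → X ≡ Y
≡ᵇ-sound []          []          _  = refl
≡ᵇ-sound (true ∷ X)  (true ∷ Y)  e  = cong (true ∷_) (≡ᵇ-sound X Y e)
≡ᵇ-sound (false ∷ X) (false ∷ Y) e  = cong (false ∷_) (≡ᵇ-sound X Y e)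
≡ᵇ-sound (true ∷ X)  (false ∷ Y) ()
≡ᵇ-sound (false ∷ X) (true ∷ Y)  ()

⊆ᵇ-sound : ∀ {N} (X Y : Subset N) → (X ⊆ᵇ Y) ≡ true → X ⊆ Y
⊆ᵇ-sound (true ∷ X)  (true ∷ Y)  e {fzero}  h = here
⊆ᵇ-sound (false ∷ X) (y ∷ Y)     e {fzero}  ()
⊆ᵇ-sound (true ∷ X)  (false ∷ Y) ()
⊆ᵇ-sound (x ∷ X)     (y ∷ Y)     e {fsuc i} h = there (⊆ᵇ-sound X Y (∧-conicalʳ _ _ e) (drop-there h))

⊆ᵇ-complete : ∀ {N} (X Y : Subset N) → X ⊆ Y → (X ⊆ᵇ Y) ≡ true
⊆ᵇ-complete []          []          s = refl
⊆ᵇ-complete (true ∷ X)  (true ∷ Y)  s = ⊆ᵇ-complete X Y (λ h → drop-there (s (there h)))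
⊆ᵇ-complete (false ∷ X) (true ∷ Y)  s = ⊆ᵇ-complete X Y (λ h → drop-there (s (there h)))
⊆ᵇ-complete (false ∷ X) (false ∷ Y) s = ⊆ᵇ-complete X Y (λ h → drop-there (s (there h)))
⊆ᵇ-complete (true ∷ X)  (false ∷ Y) s with s here
... | ()

emptyᵇ-sound : ∀ {N} (X : Subset N) → emptyᵇ X ≡ true → Empty X
emptyᵇ-sound (false ∷ X) e (fzero , ())
emptyᵇ-sound (false ∷ X) e (fsuc x , h) = emptyᵇ-sound X e (x , drop-there h)
emptyᵇ-sound (true ∷ X)  () _

emptyᵇ-complete : ∀ {N} (X : Subset N) → Empty X → emptyᵇ X ≡ true
emptyᵇ-complete []          _  = refl
emptyᵇ-complete (true ∷ X)  em = ⊥-elim (em (fzero , here))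
emptyᵇ-complete (false ∷ X) em = emptyᵇ-complete X (λ { (x , h) → em (fsuc x , there h) })

allᵇ-sound : ∀ {A : Set} (p : A → Bool) xs → allᵇ p xs ≡ true → All (λ x → p x ≡ true) xs
allᵇ-sound p []       _ = []
allᵇ-sound p (x ∷ xs) e = ∧-conicalˡ _ _ e ∷ allᵇ-sound p xs (∧-conicalʳ _ _ e)

allᵇ-complete : ∀ {A : Set} (p : A → Bool) xs → All (λ x → p x ≡ true) xs → allᵇ p xs ≡ true
allᵇ-complete p []       _        = refl
allᵇ-complete p (x ∷ xs) (e ∷ es) rewrite e = allᵇ-complete p xs es

unionOfBlocksᵇ-sound : ∀ {N} k (π : List (Subset N)) → unionOfBlocksᵇ k π ≡ true → UnionOfBlocks k π
unionOfBlocksᵇ-sound k π e = All.map inside-or-outside (allᵇ-sound _ π e)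
  where
  inside-or-outside : ∀ {B} → ((B ⊆ᵇ seg k) ∨ emptyᵇ (B ∩ seg k)) ≡ true → B ⊆ seg k ⊎ Empty (B ∩ seg k)
  inside-or-outside {B} e with B ⊆ᵇ seg k in inside
  ... | true  = inj₁ (⊆ᵇ-sound B _ inside)
  ... | false = inj₂ (emptyᵇ-sound _ e)

unionOfBlocksᵇ-complete : ∀ {N} k (π : List (Subset N)) → UnionOfBlocks k π → unionOfBlocksᵇ k π ≡ true
unionOfBlocksᵇ-complete k π u = allᵇ-complete _ π (All.map inside-or-outside u)
  where
  inside-or-outside : ∀ {B} → B ⊆ seg k ⊎ Empty (B ∩ seg k) → ((B ⊆ᵇ seg k) ∨ emptyᵇ (B ∩ seg k)) ≡ true
  inside-or-outside {B} (inj₁ s) rewrite ⊆ᵇ-complete B _ s = refl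
  inside-or-outside {B} (inj₂ em) with B ⊆ᵇ seg k
  ... | true  = refl
  ... | false = emptyᵇ-complete _ em

IsMax : ∀ {N} → Subset N → Fin N → Set
IsMax X m = m ∈ X × (∀ x → x ∈ X → toℕ x ≤ toℕ m)

maxS-nothing : ∀ {N} (X : Subset N) → maxS X ≡ nothing → Empty X
maxS-nothing (b ∷ s) e with maxS s in eq
maxS-nothing (true ∷ s)  () | nothing
maxS-nothing (false ∷ s) e  | nothing = λ { (fzero , ()) ; (fsuc x , h) → maxS-nothing s eq (x , drop-there h) }
maxS-nothing (b ∷ s)     () | just i

maxS-just : ∀ {N} (X : Subset N) m → maxS X ≡ just m → IsMax X m
maxS-just (b ∷ s) m e with maxS s in eq
maxS-just (b ∷ s) .(fsuc i) refl | just i =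
  there (proj₁ max-s) , λ { fzero _ → z≤n ; (fsuc x) h → s≤s (proj₂ max-s x (drop-there h)) }
  where
  max-s : IsMax s i
  max-s = maxS-just s i eq
maxS-just (true ∷ s) .fzero refl | nothing =
  here , λ { fzero _ → z≤n ; (fsuc x) h → ⊥-elim (maxS-nothing s eq (x , drop-there h)) }
maxS-just (false ∷ s) m () | nothing

IsMax-unique : ∀ {N} {X : Subset N} {m m'} → IsMax X m → IsMax X m' → m ≡ m'
IsMax-unique (m∈ , m-max) (m'∈ , m'-max) = toℕ-injective (≤-antisym (m'-max _ m∈) (m-max _ m'∈))

max-exists : ∀ {N} (X : Subset N) → Nonempty X → Σ (Fin N) (IsMax X)
max-exists X ne with maxS X in eq
... | just m  = m , maxS-just X m eq
... | nothing = ⊥-elim (maxS-nothing X eq ne)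

IsMax⇒maxS : ∀ {N} (X : Subset N) m → IsMax X m → maxS X ≡ just m
IsMax⇒maxS X m im with maxS X in eq
... | just m' = cong just (IsMax-unique (maxS-just X m' eq) im)
... | nothing = ⊥-elim (maxS-nothing X eq (m , proj₁ im))

MaxLt⇒< : ∀ {N} {X Y : Subset N} {x y} → IsMax X x → IsMax Y y → MaxLt X Y → toℕ x < toℕ y
MaxLt⇒< (x∈ , _) (_ , y-max) (b , bY , lt) = <-≤-trans (lt _ x∈) (y-max b bY)

<⇒MaxLt : ∀ {N} {X Y : Subset N} {x y} → IsMax X x → IsMax Y y → toℕ x < toℕ y → MaxLt X Y
<⇒MaxLt {y = y} (_ , x-max) (y∈ , _) lt = y , y∈ , λ a aX → ≤-<-trans (x-max a aX) lt

MaxLt-irrefl : ∀ {N} {X : Subset N} → ¬ MaxLt X X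
MaxLt-irrefl (b , bX , lt) = <-irrefl refl (lt b bX)

≤∧≢⇒< : ∀ {N} {x a : Fin N} → toℕ x ≤ toℕ a → x ≢ a → toℕ x < toℕ a
≤∧≢⇒< le x≢a with m≤n⇒m<n∨m≡n le
... | inj₁ lt = lt
... | inj₂ e  = ⊥-elim (x≢a (toℕ-injective e))

≤top : ∀ {n} (x : Fin (suc n)) → toℕ x ≤ n
≤top x = NP.≤-pred (toℕ<n x)

AllPairs-lookup : ∀ {A : Set} {R : A → A → Set} {xs x y} → AllPairs R xs → x L.∈ xs → y L.∈ xs →
                  x ≡ y ⊎ R x y ⊎ R y x
AllPairs-lookup (r ∷ rs) (here refl) (here refl) = inj₁ refl
AllPairs-lookup (r ∷ rs) (here refl) (there q)   = inj₂ (inj₁ (All.lookup r q))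
AllPairs-lookup (r ∷ rs) (there p)   (here refl) = inj₂ (inj₂ (All.lookup r p))
AllPairs-lookup (r ∷ rs) (there p)   (there q)   = AllPairs-lookup rs p q

AllPairs-map : ∀ {A B : Set} {R : A → A → Set} {S : B → B → Set} (f : A → B) {xs} → AllPairs R xs →
               (∀ {x y} → x L.∈ xs → y L.∈ xs → R x y → S (f x) (f y)) → AllPairs S (map f xs)
AllPairs-map f []       g = []
AllPairs-map f (r ∷ rs) g =
  All-map⁺ (All.tabulate λ m → g (here refl) (there m) (All.lookup r m))
  ∷ AllPairs-map f rs (λ a b → g (there a) (there b))

AllPairs-after : ∀ {A : Set} {R : A → A → Set} ys {x zs} → AllPairs R (ys ++ x ∷ zs) → All (R x) zs
AllPairs-after []       (r ∷ _)  = r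
AllPairs-after (y ∷ ys) (_ ∷ rs) = AllPairs-after ys rs

AllPairs-lastTwo : ∀ {A : Set} {R : A → A → Set} ys {P Z X} → AllPairs R (ys ++ P ∷ Z ∷ []) →
                   X L.∈ (ys ++ P ∷ Z ∷ []) → (X ≡ Z ⊎ R X Z) × (X ≡ Z ⊎ X ≡ P ⊎ R X P)
AllPairs-lastTwo []       ((rPZ ∷ []) ∷ _) (here refl)         = inj₂ rPZ , inj₂ (inj₁ refl)
AllPairs-lastTwo []       _                (there (here refl)) = inj₁ refl , inj₁ refl
AllPairs-lastTwo (y ∷ ys) (ry ∷ rs)        (here refl)         =
  inj₂ (All.lookup ry (∈-++⁺ʳ ys (there (here refl)))) , inj₂ (inj₂ (All.lookup ry (∈-++⁺ʳ ys (here refl))))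
AllPairs-lastTwo (y ∷ ys) (ry ∷ rs)        (there m)           = AllPairs-lastTwo ys rs m

penult-map : ∀ {A B : Set} (f : A → B) xs → penult (map f xs) ≡ Maybe.map f (penult xs)
penult-map f []              = refl
penult-map f (x ∷ [])        = refl
penult-map f (x ∷ y ∷ [])    = refl
penult-map f (x ∷ y ∷ z ∷ r) = penult-map f (y ∷ z ∷ r)

penult-split : ∀ {A : Set} (xs : List A) {P} → penult xs ≡ just P → Σ (List A) λ ys → Σ A λ Z → xs ≡ ys ++ P ∷ Z ∷ []
penult-split (x ∷ y ∷ [])    refl = [] , y , refl
penult-split (x ∷ y ∷ z ∷ r) e with penult-split (y ∷ z ∷ r) e
... | ys , Z , eq = x ∷ ys , Z , cong (x ∷_) eq

penult-exists : ∀ {A : Set} (xs : List A) → 2 ≤ length xs → Σ A λ P → penult xs ≡ just P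
penult-exists (a ∷ [])        (s≤s ())
penult-exists (a ∷ b ∷ [])    _ = a , refl
penult-exists (a ∷ b ∷ c ∷ r) _ = penult-exists (b ∷ c ∷ r) (s≤s (s≤s z≤n))

length≥2 : ∀ {A : Set} {xs : List A} {x y} → x L.∈ xs → y L.∈ xs → x ≢ y → 2 ≤ length xs
length≥2 {xs = _ ∷ _ ∷ _} _           _           _   = s≤s (s≤s z≤n)
length≥2 {xs = _ ∷ []}    (here refl) (here refl) x≢y = ⊥-elim (x≢y refl)

just-injective : ∀ {A : Set} {a b : A} → just a ≡ just b → a ≡ b
just-injective refl = refl

filterᵇ-false : ∀ {A : Set} (p : A → Bool) xs → All (λ y → p y ≡ false) xs → filterᵇ p xs ≡ []
filterᵇ-false p []       _        = refl
filterᵇ-false p (x ∷ xs) (e ∷ es) rewrite e = filterᵇ-false p xs es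

filterᵇ-last : ∀ {A : Set} (p : A → Bool) xs {x} ys → p x ≡ true → All (λ y → p y ≡ false) ys →
               Σ (List A) λ zs → filterᵇ p (xs ++ x ∷ ys) ≡ zs ++ x ∷ []
filterᵇ-last p []       ys e es rewrite e = [] , cong (_ ∷_) (filterᵇ-false p ys es)
filterᵇ-last p (x ∷ xs) ys e es with p x | filterᵇ-last p xs ys e es
... | true  | zs , eq = x ∷ zs , cong (x ∷_) eq
... | false | zs , eq = zs , eq

last-snoc : ∀ {A : Set} (zs : List A) x → last (zs ++ x ∷ []) ≡ just x
last-snoc []            x = refl
last-snoc (z ∷ [])      x = refl
last-snoc (z ∷ z' ∷ zs) x = last-snoc (z' ∷ zs) x

head-filter-nothing : (p : ℕ → Bool) (f : ℕ → ℕ) (m : ℕ) → head (filterᵇ p (applyUpTo f m)) ≡ nothing →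
                      ∀ i → i < m → p (f i) ≡ false
head-filter-nothing p f (suc m) e i lt with p (f zero) in e₀
head-filter-nothing p f (suc m) () i lt | true
head-filter-nothing p f (suc m) e zero lt | false = e₀
head-filter-nothing p f (suc m) e (suc i) (s≤s lt) | false = head-filter-nothing p (f ∘ suc) m e i lt

head-filter-just : (p : ℕ → Bool) (f : ℕ → ℕ) (m : ℕ) {k : ℕ} → head (filterᵇ p (applyUpTo f m)) ≡ just k →
                   Σ ℕ λ i → i < m × f i ≡ k × p k ≡ true × (∀ j → j < i → p (f j) ≡ false)
head-filter-just p f (suc m) e with p (f zero) in e₀
... | true with e
...   | refl = zero , s≤s z≤n , refl , e₀ , λ _ ()
head-filter-just p f (suc m) e | false with head-filter-just p (f ∘ suc) m e
... | i , lt , fi , pk , before = suc i , s≤s lt , fi , pk , λ { zero _ → e₀ ; (suc j) (s≤s l) → before j l }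

head-filter-first : (p : ℕ → Bool) (f : ℕ → ℕ) (m i : ℕ) → i < m → p (f i) ≡ true → (∀ j → j < i → p (f j) ≡ false) →
                    head (filterᵇ p (applyUpTo f m)) ≡ just (f i)
head-filter-first p f (suc m) zero    lt e before rewrite e = refl
head-filter-first p f (suc m) (suc i) (s≤s lt) e before rewrite before zero (s≤s z≤n) =
  head-filter-first p (f ∘ suc) m i lt e (λ j l → before (suc j) (s≤s l))

extend-below : ∀ {N m} {Pr : Fin N → Set} (m<N : m < N) → ¬ Pr (fromℕ< m<N) →
               ∀ y → (toℕ y < m → ¬ Pr y) → toℕ y < suc m → ¬ Pr y
extend-below {Pr = Pr} m<N np y below y≤m with m≤n⇒m<n∨m≡n (NP.≤-pred y≤m)
... | inj₁ lt = below lt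
... | inj₂ e  = subst (λ z → ¬ Pr z) (toℕ-injective (trans (toℕ-fromℕ< m<N) (sym e))) np

largest : ∀ {N} (Pr : Fin N → Set) → (∀ x → Dec (Pr x)) → ∀ m → m ≤ N →
  (∀ x → toℕ x < m → ¬ Pr x) ⊎ (Σ (Fin N) λ x → Pr x × (∀ y → toℕ x < toℕ y → toℕ y < m → ¬ Pr y))
largest Pr dec zero    _   = inj₁ (λ x ())
largest Pr dec (suc m) m<N with dec (fromℕ< m<N) | largest Pr dec m (<⇒≤ m<N)
... | yes p | _ = inj₂ (fromℕ< m<N , p , λ y x<y y≤m _ →
                    <-irrefl refl (<-≤-trans (subst (_< toℕ y) (toℕ-fromℕ< m<N) x<y) (NP.≤-pred y≤m)))
... | no np | inj₁ none = inj₁ λ x → extend-below {Pr = Pr} m<N np x (none x)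
... | no np | inj₂ (x , p , above) = inj₂ (x , p , λ y x<y → extend-below {Pr = Pr} m<N np y (above y x<y))

_≟S_ : ∀ {N} (X Y : Subset N) → Dec (X ≡ Y)
_≟S_ = ≡-dec Bool._≟_

module Partition {N} {π : List (Subset N)} (isP : IsSetPartition π) where
  open IsSetPartition isP

  same-block : ∀ {X Y x} → X L.∈ π → Y L.∈ π → x ∈ X → x ∈ Y → X ≡ Y
  same-block {x = x} Xπ Yπ xX xY with AllPairs-lookup disjoint Xπ Yπ
  ... | inj₁ X≡Y         = X≡Y
  ... | inj₂ (inj₁ disj) = ⊥-elim (disj (x , x∈p∩q⁺ (xX , xY)))
  ... | inj₂ (inj₂ disj) = ⊥-elim (disj (x , x∈p∩q⁺ (xY , xX)))

  disjoint-blocks : ∀ {X Y x} → X L.∈ π → Y L.∈ π → X ≢ Y → x ∈ X → x ∈ Y → False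
  disjoint-blocks Xπ Yπ X≢Y xX xY = X≢Y (same-block Xπ Yπ xX xY)

  block-nonempty : ∀ {X} → X L.∈ π → Nonempty X
  block-nonempty = All.lookup nonempty

  block-max : ∀ {X} → X L.∈ π → Σ (Fin N) (IsMax X)
  block-max {X} Xπ = max-exists X (block-nonempty Xπ)

  block-of : ∀ i → Σ (Subset N) λ X → X L.∈ π × i ∈ X
  block-of i = L.find (covers i)

union-uncrossed : ∀ {N k} {π : List (Subset N)} {X x y} → UnionOfBlocks k π → X L.∈ π →
                  x ∈ X → y ∈ X → toℕ x < k → k ≤ toℕ y → False
union-uncrossed {k = k} u Xπ xX yX x<k k≤y with All.lookup u Xπ
... | inj₁ X⊆ = <-irrefl refl (<-≤-trans (seg⁻ k (X⊆ yX)) k≤y)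
... | inj₂ em = em (_ , x∈p∩q⁺ (xX , seg⁺ k x<k))

record LastTwo {n} (π : List (Subset (suc n))) : Set where
  field
    P Z        : Subset (suc n)
    penult≡P   : penult π ≡ just P
    Pπ         : P L.∈ π
    Zπ         : Z L.∈ π
    top∈Z      : fromℕ n ∈ Z
    P<Z        : MaxLt P Z
    below-Z    : ∀ {X} → X L.∈ π → X ≡ Z ⊎ MaxLt X Z
    below-P    : ∀ {X} → X L.∈ π → X ≡ Z ⊎ X ≡ P ⊎ MaxLt X P

top-not-below : ∀ {n} {X Y : Subset (suc n)} → fromℕ n ∈ X → ¬ MaxLt X Y
top-not-below {n} tX (b , bY , lt) =
  <-irrefl refl (<-≤-trans (subst (_< toℕ b) (toℕ-fromℕ n) (lt _ tX)) (≤top b))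

lastTwo : ∀ {n} {π : List (Subset (suc n))} → IsSetPartition π → 2 ≤ length π → LastTwo π
lastTwo {n} {π} isP len with penult-exists π len
... | P , pen with penult-split π pen
... | ys , Z , eq = record
  { P = P ; Z = Z ; penult≡P = pen ; Pπ = Pπ ; Zπ = Zπ ; top∈Z = top∈Z ; P<Z = P<Z
  ; below-Z = λ m → proj₁ (AllPairs-lastTwo ys sorted' (split m))
  ; below-P = λ m → proj₂ (AllPairs-lastTwo ys sorted' (split m)) }
  where
  open IsSetPartition isP
  open Partition isP
  split : ∀ {X} → X L.∈ π → X L.∈ (ys ++ P ∷ Z ∷ [])
  split = subst (_ L.∈_) eq
  sorted' : AllPairs MaxLt (ys ++ P ∷ Z ∷ [])
  sorted' = subst (AllPairs MaxLt) eq sorted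
  Pπ : P L.∈ π
  Pπ = subst (P L.∈_) (sym eq) (∈-++⁺ʳ ys (here refl))
  Zπ : Z L.∈ π
  Zπ = subst (Z L.∈_) (sym eq) (∈-++⁺ʳ ys (there (here refl)))
  P<Z : MaxLt P Z
  P<Z = All.head (AllPairs-after ys sorted')
  top∈Z : fromℕ n ∈ Z
  top∈Z with block-of (fromℕ n)
  ... | X , Xπ , tX with proj₁ (AllPairs-lastTwo ys sorted' (split Xπ))
  ... | inj₁ refl = tX
  ... | inj₂ lt   = ⊥-elim (top-not-below tX lt)

module LastTwoFacts {n} {π : List (Subset (suc n))} (isP : IsSetPartition π) (two : LastTwo π) where
  open LastTwo two
  open Partition isP

  P≢Z : P ≢ Z
  P≢Z P≡Z = MaxLt-irrefl (subst (MaxLt P) (sym P≡Z) P<Z)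

  P-below-top : ∀ {x} → x ∈ P → toℕ x < n
  P-below-top xP = let b , bZ , lt = P<Z in <-≤-trans (lt _ xP) (≤top b)

  not-penult : ∀ {B} → B ≢ P → ∀ Q → penult π ≡ just Q → B ≢ Q
  not-penult B≢P Q pen-Q B≡Q = B≢P (trans B≡Q (just-injective (trans (sym pen-Q) penult≡P)))

  below-P⊆ : ∀ k → P ⊆ seg k → ∀ {X} → X L.∈ π → X ≢ Z → X ⊆ seg k
  below-P⊆ k P⊆ Xπ X≢Z xX with below-P Xπ
  ... | inj₁ X≡Z                  = ⊥-elim (X≢Z X≡Z)
  ... | inj₂ (inj₁ refl)          = P⊆ xX
  ... | inj₂ (inj₂ (b , bP , lt)) = seg⁺ k (<-trans (lt _ xX) (seg⁻ k (P⊆ bP)))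

  split⇒union : ∀ k → P ⊆ seg k → Empty (Z ∩ seg k) → UnionOfBlocks k π
  split⇒union k P⊆ Z-above = All.tabulate side
    where
    side : ∀ {X} → X L.∈ π → X ⊆ seg k ⊎ Empty (X ∩ seg k)
    side {X} Xπ with X ≟S Z
    ... | yes refl = inj₂ Z-above
    ... | no X≢Z   = inj₁ (below-P⊆ k P⊆ Xπ X≢Z)

  split⇒consecutive : ∀ k → P ⊆ seg k → Empty (Z ∩ seg k) → Consecutive Z
  split⇒consecutive k P⊆ Z-above a c x aZ cZ a≤x x≤c with block-of x
  ... | X , Xπ , xX with X ≟S Z
  ... | yes refl = xX
  ... | no X≢Z   = ⊥-elim (Z-above (a , x∈p∩q⁺ (aZ , seg⁺ k (≤-<-trans a≤x (seg⁻ k (below-P⊆ k P⊆ Xπ X≢Z xX))))))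

  consecutive⇒decomposable : Consecutive Z → Decomposable π
  consecutive⇒decomposable Z-consecutive with block-max Pπ
  ... | p , p∈P , p-max =
    suc (toℕ p) , s≤s z≤n , s≤s (P-below-top p∈P) , split⇒union (suc (toℕ p)) (λ xP → seg⁺ (suc (toℕ p)) (s≤s (p-max _ xP))) Z-above
    where
    p≤top : toℕ p ≤ toℕ (fromℕ n)
    p≤top = subst (toℕ p ≤_) (sym (toℕ-fromℕ n)) (≤top p)
    Z-above : Empty (Z ∩ seg (suc (toℕ p)))
    Z-above (z , h) with x∈p∩q⁻ Z _ h
    ... | zZ , z≤p = disjoint-blocks Pπ Zπ P≢Z p∈P
                       (Z-consecutive z (fromℕ n) p zZ top∈Z (NP.≤-pred (seg⁻ (suc (toℕ p)) z≤p)) p≤top)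

move : ∀ {N} → Subset N → Subset N → Subset N → Subset N
move M C X = (X ∩ ∁ M) ∪ (if X ≡ᵇ C then M else ⊥)

∈-move⁻ : ∀ {N} (M C X : Subset N) {x} → x ∈ move M C X → (x ∈ X × x ∉ M) ⊎ (X ≡ C × x ∈ M)
∈-move⁻ M C X h with x∈p∪q⁻ (X ∩ ∁ M) _ h
... | inj₁ h₁ = inj₁ (∈∩∁⁻ h₁)
... | inj₂ h₂ with X ≡ᵇ C in eq
...   | true  = inj₂ (≡ᵇ-sound X C eq , h₂)
...   | false = ⊥-elim (∉⊥ h₂)

∈-move⁺-stay : ∀ {N} (M C X : Subset N) {x} → x ∈ X → x ∉ M → x ∈ move M C X
∈-move⁺-stay M C X xX x∉M = x∈p∪q⁺ (inj₁ (∈∩∁⁺ xX x∉M))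

∈-move⁺-moved : ∀ {N} (M C : Subset N) {x} → x ∈ M → x ∈ move M C C
∈-move⁺-moved M C {x} xM =
  x∈p∪q⁺ {p = C ∩ ∁ M} (inj₂ (subst (λ b → x ∈ (if b then M else ⊥)) (sym (≡ᵇ-refl C)) xM))

-- Moving M ⊆ A into another block C of a partition ρ yields a partition, provided
-- M avoids max A and lies below max C (so that all maxima, hence the order of the
-- blocks, are unchanged); moving M back into the image of A undoes it.
module Move {N} {ρ : List (Subset N)} (isP : IsSetPartition ρ) (A C M : Subset N)
  (Aρ : A L.∈ ρ) (Cρ : C L.∈ ρ) (A≢C : A ≢ C) (M⊆A : M ⊆ A)
  (max-A∉M : ∀ m → IsMax A m → m ∉ M) (M≤max-C : ∀ c m → IsMax C c → m ∈ M → toℕ m ≤ toℕ c) where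

  open Partition isP
  open IsSetPartition isP

  g : Subset N → Subset N
  g = move M C

  τ : List (Subset N)
  τ = map g ρ

  M-only-in-A : ∀ {X x} → X L.∈ ρ → X ≢ A → x ∈ X → x ∉ M
  M-only-in-A Xρ X≢A xX xM = disjoint-blocks Xρ Aρ X≢A xX (M⊆A xM)

  g-other : ∀ {X} → X L.∈ ρ → X ≢ A → X ≢ C → g X ≡ X
  g-other {X} Xρ X≢A X≢C = ⊆-antisym to (λ xX → ∈-move⁺-stay M C X xX (M-only-in-A Xρ X≢A xX))
    where
    to : g X ⊆ X
    to h with ∈-move⁻ M C X h
    ... | inj₁ (xX , _)  = xX
    ... | inj₂ (X≡C , _) = ⊥-elim (X≢C X≡C)

  ∈gA⁻ : ∀ {x} → x ∈ g A → x ∈ A × x ∉ M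
  ∈gA⁻ h with ∈-move⁻ M C A h
  ... | inj₁ p         = p
  ... | inj₂ (A≡C , _) = ⊥-elim (A≢C A≡C)

  ∈gC⁻ : ∀ {x} → x ∈ g C → x ∈ C ⊎ x ∈ M
  ∈gC⁻ h with ∈-move⁻ M C C h
  ... | inj₁ (xC , _) = inj₁ xC
  ... | inj₂ (_ , xM) = inj₂ xM

  ∈gC⁺ : ∀ {x} → x ∈ C ⊎ x ∈ M → x ∈ g C
  ∈gC⁺ {x} (inj₁ xC) with x ∈? M
  ... | yes xM = ∈-move⁺-moved M C xM
  ... | no x∉M = ∈-move⁺-stay M C C xC x∉M
  ∈gC⁺ (inj₂ xM) = ∈-move⁺-moved M C xM

  g-max : ∀ {X m} → X L.∈ ρ → IsMax X m → IsMax (g X) m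
  g-max {X} {m} Xρ (mX , m-max) = ∈-move⁺-stay M C X mX m∉M , bound
    where
    m∉M : m ∉ M
    m∉M with X ≟S A
    ... | yes refl = max-A∉M m (mX , m-max)
    ... | no X≢A   = M-only-in-A Xρ X≢A mX
    bound : ∀ x → x ∈ g X → toℕ x ≤ toℕ m
    bound x h with ∈-move⁻ M C X h
    ... | inj₁ (xX , _)   = m-max x xX
    ... | inj₂ (refl , xM) = M≤max-C m x (mX , m-max) xM

  moved-partition : IsSetPartition τ
  moved-partition = record
    { nonempty = All-map⁺ (All.tabulate λ Xρ → let m , im = block-max Xρ in m , proj₁ (g-max Xρ im))
    ; disjoint = AllPairs-map g disjoint stays-disjoint
    ; covers   = covered
    ; sorted   = AllPairs-map g sorted stays-sorted }
    where
    stays-disjoint : ∀ {X Y} → X L.∈ ρ → Y L.∈ ρ → Empty (X ∩ Y) → Empty (g X ∩ g Y)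
    stays-disjoint {X} {Y} Xρ Yρ em (x , h) with x∈p∩q⁻ (g X) (g Y) h
    ... | hX , hY with ∈-move⁻ M C X hX | ∈-move⁻ M C Y hY
    ... | inj₁ (xX , _)   | inj₁ (xY , _)   = em (x , x∈p∩q⁺ (xX , xY))
    ... | inj₁ (_ , x∉M)  | inj₂ (_ , xM)   = x∉M xM
    ... | inj₂ (_ , xM)   | inj₁ (_ , x∉M)  = x∉M xM
    ... | inj₂ (refl , _) | inj₂ (refl , _) = let z , zX = block-nonempty Xρ in em (z , x∈p∩q⁺ (zX , zX))
    covered : ∀ i → Any (i ∈_) τ
    covered i with block-of i
    ... | X , Xρ , iX with i ∈? M
    ... | yes iM  = L.lose (∈-map⁺ g Cρ) (∈-move⁺-moved M C iM)
    ... | no i∉M = L.lose (∈-map⁺ g Xρ) (∈-move⁺-stay M C X iX i∉M)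
    stays-sorted : ∀ {X Y} → X L.∈ ρ → Y L.∈ ρ → MaxLt X Y → MaxLt (g X) (g Y)
    stays-sorted Xρ Yρ lt =
      let x , ix = block-max Xρ ; y , iy = block-max Yρ in
      <⇒MaxLt (g-max Xρ ix) (g-max Yρ iy) (MaxLt⇒< ix iy lt)

  ∈τ⁻ : ∀ {Y} → Y L.∈ τ → Σ (Subset N) λ X → X L.∈ ρ × Y ≡ g X
  ∈τ⁻ = ∈-map⁻ g

  -- g is injective on the blocks, as max A survives in g A.
  g-injective-at-A : ∀ {X} → X L.∈ ρ → g X ≡ g A → X ≡ A
  g-injective-at-A {X} Xρ gX≡gA with block-max Aρ
  ... | a , ia with ∈-move⁻ M C X (subst (a ∈_) (sym gX≡gA) (∈-move⁺-stay M C A (proj₁ ia) (max-A∉M a ia)))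
  ...   | inj₁ (aX , _) = same-block Xρ Aρ aX (proj₁ ia)
  ...   | inj₂ (_ , aM) = ⊥-elim (max-A∉M a ia aM)

  move-back-block : ∀ {X} → X L.∈ ρ → move M (g A) (g X) ≡ X
  move-back-block {X} Xρ = ⊆-antisym to from
    where
    to : move M (g A) (g X) ⊆ X
    to {x} h with ∈-move⁻ M (g A) (g X) h
    ... | inj₂ (gX≡gA , xM) = subst (x ∈_) (sym (g-injective-at-A Xρ gX≡gA)) (M⊆A xM)
    ... | inj₁ (h₁ , x∉M) with ∈-move⁻ M C X h₁
    ...   | inj₁ (xX , _) = xX
    ...   | inj₂ (_ , xM) = ⊥-elim (x∉M xM)
    from : X ⊆ move M (g A) (g X)
    from {x} xX with x ∈? M
    ... | no x∉M = ∈-move⁺-stay M (g A) (g X) (∈-move⁺-stay M C X xX x∉M) x∉M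
    ... | yes xM with same-block Xρ Aρ xX (M⊆A xM)
    ...   | refl = ∈-move⁺-moved M (g A) xM

  move-back : map (move M (g A)) τ ≡ ρ
  move-back = trans (sym (LP.map-∘ ρ)) (LP.map-id-local (All.tabulate move-back-block))

record FirstComponent {n} (π : List (Subset (suc n))) : Set where
  field
    a₀     : Fin (suc n)
    a₀<n   : toℕ a₀ < n
    splits : UnionOfBlocks (suc (toℕ a₀)) π
    least  : ∀ k → 1 ≤ k → k ≤ toℕ a₀ → ¬ UnionOfBlocks k π

  decomposable : Decomposable π
  decomposable = suc (toℕ a₀) , s≤s z≤n , s≤s a₀<n , splits

-- T π spelled out as a chain of Maybe-steps, named so that each step can be
-- evaluated separately.
module Steps {N} (π : List (Subset N)) where
  afterPenult : Subset N → Fin N → Subset N → Maybe (List (Subset N))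
  afterPenult L m P = just (map (move (L - m) P) π)

  afterMax : Subset N → Fin N → Maybe (List (Subset N))
  afterMax L m = penult π >>= afterPenult L m

  afterLast : Subset N → Maybe (List (Subset N))
  afterLast L = maxS L >>= afterMax L

  afterSplit : ℕ → Maybe (List (Subset N))
  afterSplit k = last (filterᵇ (λ B → B ⊆ᵇ seg k) π) >>= afterLast

firstSplit : ∀ {n} → List (Subset (suc n)) → Maybe ℕ
firstSplit {n} π = head (filterᵇ (λ k → unionOfBlocksᵇ k π) (applyUpTo suc n))

T-unfold : ∀ {n} (π : List (Subset (suc n))) → T π ≡ fromMaybe π (firstSplit π >>= Steps.afterSplit π)
T-unfold {n} π = cong (λ ks → fromMaybe π (head (filterᵇ (λ k → unionOfBlocksᵇ k π) ks) >>= Steps.afterSplit π))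
                      (LP.map-applyUpTo _ suc n)

element-at : ∀ {n i} → i < n → Σ (Fin (suc n)) λ a → toℕ a ≡ i
element-at i<n = fromℕ< (NP.m<n⇒m<1+n i<n) , toℕ-fromℕ< _

T-cases : ∀ {n} (π : List (Subset (suc n))) → (Indecomposable π × T π ≡ π) ⊎ FirstComponent π
T-cases {n} π with firstSplit π in eq
... | nothing = inj₁ (indecomposable , trans (T-unfold π) (cong (λ h → fromMaybe π (h >>= Steps.afterSplit π)) eq))
  where
  indecomposable : Indecomposable π
  indecomposable (suc j , _ , s≤s j<n , u)
    with trans (sym (head-filter-nothing _ suc n eq j j<n)) (unionOfBlocksᵇ-complete (suc j) π u)
  ... | ()
... | just k with head-filter-just _ suc n eq
... | i , i<n , refl , splits , before with element-at i<n
... | a , refl = inj₂ record { a₀ = a ; a₀<n = i<n ; splits = unionOfBlocksᵇ-sound (suc (toℕ a)) π splits ; least = least }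
  where
  least : ∀ k → 1 ≤ k → k ≤ toℕ a → ¬ UnionOfBlocks k π
  least (suc j) _ j<a u with trans (sym (before j j<a)) (unionOfBlocksᵇ-complete (suc j) π u)
  ... | ()

-- Given the block L containing a₀ and the penultimate block P, T moves L - a₀
-- into P: the first split point is a₀+1, L is the last block inside [a₀+1]
-- (all later blocks have larger maxima) and a₀ = max L.
module TweakFormula {n} {π : List (Subset (suc n))} (isP : IsSetPartition π) (fc : FirstComponent π)
  {L : Subset (suc n)} (Lπ : L L.∈ π) (a₀∈L : FirstComponent.a₀ fc ∈ L) where
  open FirstComponent fc
  open IsSetPartition isP

  k₀ : ℕ
  k₀ = suc (toℕ a₀)

  L⊆[k₀] : L ⊆ seg k₀
  L⊆[k₀] with All.lookup splits Lπ
  ... | inj₁ L⊆ = L⊆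
  ... | inj₂ em = ⊥-elim (em (a₀ , x∈p∩q⁺ (a₀∈L , seg⁺ k₀ ≤-refl)))

  a₀-max : IsMax L a₀
  a₀-max = a₀∈L , λ x xL → NP.≤-pred (seg⁻ k₀ (L⊆[k₀] xL))

  firstSplit≡k₀ : firstSplit π ≡ just k₀
  firstSplit≡k₀ = head-filter-first _ suc n (toℕ a₀) a₀<n (unionOfBlocksᵇ-complete k₀ π splits)
    (λ j j<a₀ → ¬-not (λ e → least (suc j) (s≤s z≤n) j<a₀ (unionOfBlocksᵇ-sound (suc j) π e)))

  last-inside≡L : last (filterᵇ (λ B → B ⊆ᵇ seg k₀) π) ≡ just L
  last-inside≡L with ∈-∃++ Lπ
  ... | ys , zs , π≡ with filterᵇ-last (λ B → B ⊆ᵇ seg k₀) ys zs (⊆ᵇ-complete L _ L⊆[k₀]) later-outside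
    where
    later-outside : All (λ Y → (Y ⊆ᵇ seg k₀) ≡ false) zs
    later-outside = All.map outside (AllPairs-after ys (subst (AllPairs MaxLt) π≡ sorted))
      where
      outside : ∀ {Y} → MaxLt L Y → (Y ⊆ᵇ seg k₀) ≡ false
      outside {Y} (b , bY , lt) = ¬-not λ e → <-irrefl refl (<-≤-trans (seg⁻ k₀ (⊆ᵇ-sound Y _ e bY)) (lt a₀ a₀∈L))
  ... | zs' , filter≡ = trans (cong (λ ρ → last (filterᵇ (λ B → B ⊆ᵇ seg k₀) ρ)) π≡)
                             (trans (cong last filter≡) (last-snoc zs' L))

  T≡move : ∀ {P} → penult π ≡ just P → T π ≡ map (move (L - a₀) P) π
  T≡move {P} pen = begin
    T π                                                 ≡⟨ T-unfold π ⟩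
    fromMaybe π (firstSplit π >>= afterSplit)          ≡⟨ cong (λ h → fromMaybe π (h >>= afterSplit)) firstSplit≡k₀ ⟩
    fromMaybe π (last (filterᵇ _ π) >>= afterLast)     ≡⟨ cong (λ h → fromMaybe π (h >>= afterLast)) last-inside≡L ⟩
    fromMaybe π (maxS L >>= afterMax L)                ≡⟨ cong (λ h → fromMaybe π (h >>= afterMax L)) (IsMax⇒maxS L a₀ a₀-max) ⟩
    fromMaybe π (penult π >>= afterPenult L a₀)        ≡⟨ cong (λ h → fromMaybe π (h >>= afterPenult L a₀)) pen ⟩
    map (move (L - a₀) P) π                             ∎
    where
    open Steps π
    open ≡-Reasoning

Straddles : ∀ {N} → Subset N → Fin N → Set
Straddles {N} X a = (Σ (Fin N) λ x → x ∈ X × x <F a) × (Σ (Fin N) λ y → y ∈ X × a <F y)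

Straddled : ∀ {n} → List (Subset (suc n)) → Fin (suc n) → Set
Straddled {n} π a =
  Σ (Subset (suc n)) λ B → B L.∈ π × (∀ P → penult π ≡ just P → B ≢ P) × 2 ≤ ∣ B ∣ × Straddles B a

Unstraddled : ∀ {n} → List (Subset (suc n)) → Fin (suc n) → Set
Unstraddled π a = ⁅ a ⁆ L.∈ π × ¬ Straddled π a

straddles⇒big : ∀ {N} {X : Subset N} {a} → Straddles X a → 2 ≤ ∣ X ∣
straddles⇒big ((x , xX , x<a) , (y , yX , a<y)) = two-elements⇒big xX yX λ { refl → <-irrefl refl (<-trans x<a a<y) }

singleton-not-straddling : ∀ {N} {b a : Fin N} → ¬ Straddles ⁅ b ⁆ a
singleton-not-straddling ((x , xb , x<a) , (y , yb , a<y)) =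
  <-irrefl (cong toℕ (trans (∈⁅⁆ xb) (sym (∈⁅⁆ yb)))) (<-trans x<a a<y)

union-not-straddled : ∀ {N} {π : List (Subset N)} {X a} → UnionOfBlocks (suc (toℕ a)) π → X L.∈ π → ¬ Straddles X a
union-not-straddled u Xπ ((x , xX , x<a) , (y , yX , a<y)) = union-uncrossed u Xπ xX yX (<-trans x<a (NP.n<1+n _)) a<y

-- The inverse of the tweak at a: move the elements of the penultimate block
-- lying below a into the singleton {a}.
untweak : ∀ {n} → Fin (suc n) → List (Subset (suc n)) → List (Subset (suc n))
untweak a σ = maybe (λ P → map (move (P ∩ seg (toℕ a)) ⁅ a ⁆) σ) σ (penult σ)

module TweakOnB {n} {π : List (Subset (suc n))} (hB : InB n π) (fc : FirstComponent π) where
  open FirstComponent fc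

  isP : IsSetPartition π
  isP = proj₁ hB

  last-not-consecutive : ∀ B → B L.∈ π → fromℕ n ∈ B → ¬ Consecutive B
  last-not-consecutive = proj₁ (proj₂ hB)

  all-straddled : ∀ a → ⁅ a ⁆ L.∈ π → Straddled π a
  all-straddled = proj₂ (proj₂ hB)

  open Partition isP

  k₀ : ℕ
  k₀ = suc (toℕ a₀)

  top∉[k₀] : fromℕ n ∉ seg k₀
  top∉[k₀] h = <-irrefl refl (<-≤-trans a₀<n (NP.≤-pred (subst (_< k₀) (toℕ-fromℕ n) (seg⁻ k₀ h))))

  L : Subset (suc n)
  L = proj₁ (block-of a₀)

  Lπ : L L.∈ π
  Lπ = proj₁ (proj₂ (block-of a₀))

  a₀∈L : a₀ ∈ L
  a₀∈L = proj₂ (proj₂ (block-of a₀))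

  open TweakFormula isP fc Lπ a₀∈L using (L⊆[k₀]; a₀-max; T≡move)

  two : LastTwo π
  two = lastTwo isP (length≥2 Lπ top-block∈π L≢top-block)
    where
    top-block∈π : proj₁ (block-of (fromℕ n)) L.∈ π
    top-block∈π = proj₁ (proj₂ (block-of (fromℕ n)))
    L≢top-block : L ≢ proj₁ (block-of (fromℕ n))
    L≢top-block L≡ = top∉[k₀] (L⊆[k₀] (subst (fromℕ n ∈_) (sym L≡) (proj₂ (proj₂ (block-of (fromℕ n))))))

  open LastTwo two
  open LastTwoFacts isP two

  Z-above-a₀ : Empty (Z ∩ seg k₀)
  Z-above-a₀ with All.lookup splits Zπ
  ... | inj₁ Z⊆ = ⊥-elim (top∉[k₀] (Z⊆ top∈Z))
  ... | inj₂ em = em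

  -- Condition (i) forces P above a₀ as well: otherwise Z would be consecutive.
  P-above-a₀ : Empty (P ∩ seg k₀)
  P-above-a₀ with All.lookup splits Pπ
  ... | inj₂ em = em
  ... | inj₁ P⊆ = ⊥-elim (last-not-consecutive Z Zπ top∈Z (split⇒consecutive k₀ P⊆ Z-above-a₀))

  P-elements-above : ∀ {c} → c ∈ P → k₀ ≤ toℕ c
  P-elements-above {c} cP = ≮⇒≥ λ c<k₀ → P-above-a₀ (c , x∈p∩q⁺ (cP , seg⁺ k₀ c<k₀))

  L≢P : L ≢ P
  L≢P L≡P = P-above-a₀ (a₀ , x∈p∩q⁺ (subst (a₀ ∈_) L≡P a₀∈L , seg⁺ k₀ ≤-refl))

  Z≢L : Z ≢ L
  Z≢L Z≡L = top∉[k₀] (L⊆[k₀] (subst (fromℕ n ∈_) Z≡L top∈Z))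

  L-is-⁅a₀⁆ : ¬ (Σ (Fin (suc n)) λ m → m ∈ L × m ≢ a₀) → L ≡ ⁅ a₀ ⁆
  L-is-⁅a₀⁆ no-other = ⊆-antisym (λ {x} xL → subst (_∈ ⁅ a₀ ⁆) (sym (only x xL)) (x∈⁅x⁆ a₀))
                                 (λ h → subst (_∈ L) (sym (∈⁅⁆ h)) a₀∈L)
    where
    only : ∀ x → x ∈ L → x ≡ a₀
    only x xL with x FP.≟ a₀
    ... | yes x≡a₀ = x≡a₀
    ... | no x≢a₀  = ⊥-elim (no-other (x , xL , x≢a₀))

  -- Condition (ii) forces L to contain an element besides a₀: a singleton {a₀}
  -- would not be straddled, as [a₀+1] is a union of blocks.
  L-has-more : Σ (Fin (suc n)) λ m → m ∈ L × m ≢ a₀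
  L-has-more with FP.any? (λ m → (m ∈? L) ×-dec ¬? (m FP.≟ a₀))
  ... | yes found = found
  ... | no none with all-straddled a₀ (subst (L._∈ π) (L-is-⁅a₀⁆ none) Lπ)
  ...   | B , Bπ , _ , _ , straddles = ⊥-elim (union-not-straddled splits Bπ straddles)

  M : Subset (suc n)
  M = L - a₀

  M⊆L : M ⊆ L
  M⊆L h = proj₁ (∈-minus⁻ h)

  max-L∉M : ∀ m → IsMax L m → m ∉ M
  max-L∉M m im h = proj₂ (∈-minus⁻ h) (IsMax-unique im a₀-max)

  M≤max-P : ∀ c m → IsMax P c → m ∈ M → toℕ m ≤ toℕ c
  M≤max-P c m (cP , _) h = <⇒≤ (<-≤-trans (s≤s (proj₂ a₀-max m (M⊆L h))) (P-elements-above cP))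

  open Move isP L P M Lπ Pπ L≢P M⊆L max-L∉M M≤max-P

  m₁ : Fin (suc n)
  m₁ = proj₁ L-has-more

  m₁∈M : m₁ ∈ M
  m₁∈M = ∈-minus⁺ (proj₁ (proj₂ L-has-more)) (proj₂ (proj₂ L-has-more))

  m₁<a₀ : toℕ m₁ < toℕ a₀
  m₁<a₀ = ≤∧≢⇒< (proj₂ a₀-max _ (proj₁ (proj₂ L-has-more))) (proj₂ (proj₂ L-has-more))

  T≡τ : T π ≡ τ
  T≡τ = T≡move penult≡P

  penult-τ : penult τ ≡ just (g P)
  penult-τ = trans (penult-map g π) (cong (Maybe.map g) penult≡P)

  gL≡⁅a₀⁆ : g L ≡ ⁅ a₀ ⁆
  gL≡⁅a₀⁆ = ⊆-antisym to (λ h → subst (_∈ g L) (sym (∈⁅⁆ h)) (∈-move⁺-stay M P L a₀∈L (max-L∉M a₀ a₀-max)))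
    where
    to : g L ⊆ ⁅ a₀ ⁆
    to {x} h with ∈gA⁻ h
    ... | xL , x∉M with x FP.≟ a₀
    ...   | yes refl = x∈⁅x⁆ a₀
    ...   | no x≢a₀  = ⊥-elim (x∉M (∈-minus⁺ xL x≢a₀))

  gZ≡Z : g Z ≡ Z
  gZ≡Z = g-other Zπ Z≢L (P≢Z ∘ sym)

  τ-side : ∀ k → UnionOfBlocks k τ → ∀ {X} → X L.∈ π → g X ⊆ seg k ⊎ Empty (g X ∩ seg k)
  τ-side k u Xπ = All.lookup u (∈-map⁺ g Xπ)

  union-below-a₀ : ∀ k → k ≤ toℕ a₀ → UnionOfBlocks k τ → UnionOfBlocks k π
  union-below-a₀ k k≤a₀ u = All.tabulate side
    where
    gP-above : Empty (g P ∩ seg k)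
    gP-above with τ-side k u Pπ
    ... | inj₂ em  = em
    ... | inj₁ gP⊆ = λ _ → let p , pP = block-nonempty Pπ in
      <-irrefl refl (<-≤-trans (seg⁻ k (gP⊆ (∈gC⁺ (inj₁ pP)))) (≤-trans k≤a₀ (≤-trans (NP.n≤1+n _) (P-elements-above pP))))
    L-part : ∀ x → x ∈ L → toℕ x < k → False
    L-part x xL x<k with x FP.≟ a₀
    ... | yes refl = <-irrefl refl (<-≤-trans x<k k≤a₀)
    ... | no x≢a₀  = gP-above (x , x∈p∩q⁺ (∈gC⁺ (inj₂ (∈-minus⁺ xL x≢a₀)) , seg⁺ k x<k))
    side : ∀ {X} → X L.∈ π → X ⊆ seg k ⊎ Empty (X ∩ seg k)
    side {X} Xπ with X ≟S L | X ≟S P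
    ... | yes refl | _      = inj₂ λ { (x , h) → let xL , x<k = x∈p∩q⁻ L (seg k) h in L-part x xL (seg⁻ k x<k) }
    ... | no _     | yes refl = inj₂ λ { (x , h) → let xP , x<k = x∈p∩q⁻ P (seg k) h in
                                                   gP-above (x , x∈p∩q⁺ (∈gC⁺ (inj₁ xP) , x<k)) }
    ... | no X≢L   | no X≢P = subst (λ W → W ⊆ seg k ⊎ Empty (W ∩ seg k)) (g-other Xπ X≢L X≢P) (τ-side k u Xπ)

  union-above-a₀ : ∀ k → toℕ a₀ < k → k < suc n → UnionOfBlocks k τ → Consecutive Z
  union-above-a₀ k a₀<k k≤n u = split⇒consecutive k P⊆ Z-above
    where
    P⊆ : P ⊆ seg k
    P⊆ pP with τ-side k u Pπ
    ... | inj₁ gP⊆ = gP⊆ (∈gC⁺ (inj₁ pP))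
    ... | inj₂ em  = ⊥-elim (em (m₁ , x∈p∩q⁺ (∈gC⁺ (inj₂ m₁∈M) , seg⁺ k (<-trans m₁<a₀ a₀<k))))
    Z-above : Empty (Z ∩ seg k)
    Z-above with τ-side k u Zπ
    ... | inj₂ em  = subst (λ W → Empty (W ∩ seg k)) gZ≡Z em
    ... | inj₁ gZ⊆ = λ _ → <-irrefl refl (<-≤-trans
            (subst (_< k) (toℕ-fromℕ n) (seg⁻ k (gZ⊆ (subst (fromℕ n ∈_) (sym gZ≡Z) top∈Z)))) (NP.≤-pred k≤n))

  τ-indecomposable : Indecomposable τ
  τ-indecomposable (k , 1≤k , k<N , u) with k ≤? toℕ a₀
  ... | yes k≤a₀ = least k 1≤k k≤a₀ (union-below-a₀ k k≤a₀ u)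
  ... | no k≰a₀  = last-not-consecutive Z Zπ top∈Z (union-above-a₀ k (≰⇒> k≰a₀) k<N u)

  τ∈IP* : InIPstar n τ
  τ∈IP* = moved-partition , τ-indecomposable ,
          subst (2 ≤_) (sym (LP.length-map g π)) (length≥2 Lπ Zπ (Z≢L ∘ sym))

  a₀-unstraddled : Unstraddled τ a₀
  a₀-unstraddled = subst (L._∈ τ) gL≡⁅a₀⁆ (∈-map⁺ g Lπ) , not-straddled
    where
    not-straddled : ¬ Straddled τ a₀
    not-straddled (B , Bτ , not-pen , _ , straddles) with ∈τ⁻ Bτ
    ... | X , Xπ , refl with X ≟S P | X ≟S L
    ... | yes refl | _        = not-pen (g P) penult-τ refl
    ... | no _     | yes refl = singleton-not-straddling (subst (λ W → Straddles W a₀) gL≡⁅a₀⁆ straddles)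
    ... | no X≢P   | no X≢L   =
      union-not-straddled splits Xπ (subst (λ W → Straddles W a₀) (g-other Xπ X≢L X≢P) straddles)

  -- Every singleton of τ above a₀ is a singleton of π, straddled by the same block.
  above-a₀-straddled : ∀ b → ⁅ b ⁆ L.∈ τ → toℕ a₀ < toℕ b → Straddled τ b
  above-a₀-straddled b bτ a₀<b with ∈τ⁻ bτ
  ... | X , Xπ , ⁅b⁆≡gX with X ≟S L | X ≟S P
  ... | yes refl | _ =
    ⊥-elim (<-irrefl (cong toℕ (sym (∈⁅⁆ (subst (b ∈_) (trans ⁅b⁆≡gX gL≡⁅a₀⁆) (x∈⁅x⁆ b))))) a₀<b)
  ... | no _ | yes refl =
    ⊥-elim (<-irrefl (cong toℕ (∈⁅⁆ (subst (m₁ ∈_) (sym ⁅b⁆≡gX) (∈gC⁺ (inj₂ m₁∈M))))) (<-trans m₁<a₀ a₀<b))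
  ... | no X≢L | no X≢P with all-straddled b (subst (L._∈ π) (sym (trans ⁅b⁆≡gX (g-other Xπ X≢L X≢P))) Xπ)
  ...   | B , Bπ , B-not-pen , big , straddles = B , Bτ , not-pen , big , straddles
    where
    B≢L : B ≢ L
    B≢L refl = let y , yB , b<y = proj₂ straddles in
      <-irrefl refl (<-≤-trans (<-trans a₀<b b<y) (proj₂ a₀-max y yB))
    B≢P : B ≢ P
    B≢P = B-not-pen P penult≡P
    Bτ : B L.∈ τ
    Bτ = subst (L._∈ τ) (g-other Bπ B≢L B≢P) (∈-map⁺ g Bπ)
    not-pen : ∀ Q → penult τ ≡ just Q → B ≢ Q
    not-pen Q pen-Q B≡Q with trans (sym pen-Q) penult-τ
    ... | refl = let p , pP = block-nonempty Pπ in
      disjoint-blocks Bπ Pπ B≢P (subst (p ∈_) (sym B≡Q) (∈gC⁺ (inj₁ pP))) pP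

  gP-below-a₀≡M : g P ∩ seg (toℕ a₀) ≡ M
  gP-below-a₀≡M = ⊆-antisym to from
    where
    to : g P ∩ seg (toℕ a₀) ⊆ M
    to h with x∈p∩q⁻ (g P) _ h
    ... | xgP , x<a₀ with ∈gC⁻ xgP
    ...   | inj₂ xM = xM
    ...   | inj₁ xP = ⊥-elim (<-irrefl refl (<-≤-trans (<-trans (seg⁻ (toℕ a₀) x<a₀) (NP.n<1+n _)) (P-elements-above xP)))
    from : M ⊆ g P ∩ seg (toℕ a₀)
    from {x} xM = x∈p∩q⁺ (∈gC⁺ (inj₂ xM) , seg⁺ (toℕ a₀) (≤∧≢⇒< (proj₂ a₀-max x (M⊆L xM)) (proj₂ (∈-minus⁻ xM))))

  untweak-τ : untweak a₀ τ ≡ π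
  untweak-τ = begin
    untweak a₀ τ                              ≡⟨ cong (maybe (λ Q → map (move (Q ∩ seg (toℕ a₀)) ⁅ a₀ ⁆) τ) τ) penult-τ ⟩
    map (move (g P ∩ seg (toℕ a₀)) ⁅ a₀ ⁆) τ ≡⟨ cong₂ (λ A B → map (move A B) τ) gP-below-a₀≡M (sym gL≡⁅a₀⁆) ⟩
    map (move M (g L)) τ                      ≡⟨ move-back ⟩
    π                                         ∎
    where open ≡-Reasoning

  T∈IP* : InIPstar n (T π)
  T∈IP* = subst (InIPstar n) (sym T≡τ) τ∈IP*

  a₀-unstraddled-in-T : Unstraddled (T π) a₀
  a₀-unstraddled-in-T = subst (λ ρ → Unstraddled ρ a₀) (sym T≡τ) a₀-unstraddled

  above-a₀-straddled-in-T : ∀ b → ⁅ b ⁆ L.∈ T π → toℕ a₀ < toℕ b → Straddled (T π) b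
  above-a₀-straddled-in-T = subst (λ ρ → ∀ b → ⁅ b ⁆ L.∈ ρ → toℕ a₀ < toℕ b → Straddled ρ b) (sym T≡τ) above-a₀-straddled

  untweak-T : untweak a₀ (T π) ≡ π
  untweak-T = trans (cong (untweak a₀) T≡τ) untweak-τ

straddles? : ∀ {N} (X : Subset N) a → Dec (Straddles X a)
straddles? X a = FP.any? (λ x → (x ∈? X) ×-dec (toℕ x <? toℕ a)) ×-dec FP.any? (λ y → (y ∈? X) ×-dec (toℕ a <? toℕ y))

module SingletonsOfIP* {n} (1≤n : 1 ≤ n) {σ : List (Subset (suc n))} (hI : InIPstar n σ) where
  isP : IsSetPartition σ
  isP = proj₁ hI

  indecomposable : Indecomposable σ
  indecomposable = proj₁ (proj₂ hI)

  two : LastTwo σ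
  two = lastTwo isP (proj₂ (proj₂ hI))

  open Partition isP
  open LastTwo two
  open LastTwoFacts isP two

  Z-not-consecutive : ¬ Consecutive Z
  Z-not-consecutive = indecomposable ∘ consecutive⇒decomposable

  side-of-singleton : ∀ {a X} → ⁅ a ⁆ L.∈ σ → X L.∈ σ → ¬ Straddles X a →
                      X ⊆ seg (suc (toℕ a)) ⊎ Empty (X ∩ seg (suc (toℕ a)))
  side-of-singleton {a} {X} aσ Xσ not-straddling with FP.any? (λ y → (y ∈? X) ×-dec (toℕ a <? toℕ y))
  ... | no none-above = inj₁ λ {x} xX → seg⁺ (suc (toℕ a)) (s≤s (≮⇒≥ λ a<x → none-above (x , xX , a<x)))
  ... | yes (y , yX , a<y) = inj₂ λ { (x , h) → let xX , x≤a = x∈p∩q⁻ X _ h in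
                                      below-a x xX (NP.≤-pred (seg⁻ (suc (toℕ a)) x≤a)) }
    where
    below-a : ∀ x → x ∈ X → toℕ x ≤ toℕ a → False
    below-a x xX x≤a with x FP.≟ a
    ... | yes refl = <-irrefl (cong toℕ (sym (∈⁅⁆ (subst (y ∈_) (same-block Xσ aσ xX (x∈⁅x⁆ x)) yX)))) a<y
    ... | no x≢a   = not-straddling ((x , xX , ≤∧≢⇒< x≤a x≢a) , (y , yX , a<y))

  -- Every singleton {a} of σ is straddled by some block: otherwise [a+1] would
  -- be a union of blocks (for a < n), or Z = {n} and [n] would be one.
  straddler : ∀ {a} → ⁅ a ⁆ L.∈ σ → Σ (Subset (suc n)) λ X → X L.∈ σ × Straddles X a
  straddler {a} aσ with Any.any? (λ X → straddles? X a) σ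
  ... | yes some = L.find some
  ... | no none with toℕ a <? n
  ...   | yes a<n = ⊥-elim (indecomposable (suc (toℕ a) , s≤s z≤n , s≤s a<n ,
                      All.tabulate λ Xσ → side-of-singleton aσ Xσ (λ st → none (L.lose Xσ st))))
  ...   | no a≮n  = ⊥-elim (indecomposable (n , 1≤n , NP.n<1+n n ,
                      split⇒union n (λ xP → seg⁺ n (P-below-top xP)) Z-above))
    where
    a≡top : a ≡ fromℕ n
    a≡top = toℕ-injective (trans (≤-antisym (≤top a) (≮⇒≥ a≮n)) (sym (toℕ-fromℕ n)))
    ⁅a⁆≡Z : ⁅ a ⁆ ≡ Z
    ⁅a⁆≡Z = same-block aσ Zπ (subst (_∈ ⁅ a ⁆) a≡top (x∈⁅x⁆ a)) top∈Z
    Z-above : Empty (Z ∩ seg n)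
    Z-above (z , h) with x∈p∩q⁻ Z _ h
    ... | zZ , z<n = <-irrefl (trans (cong toℕ (trans (∈⁅⁆ (subst (z ∈_) (sym ⁅a⁆≡Z) zZ)) a≡top)) (toℕ-fromℕ n))
                              (seg⁻ n z<n)

  not-penult? : ∀ B → Dec (∀ Q → penult σ ≡ just Q → B ≢ Q)
  not-penult? B with B ≟S P
  ... | yes B≡P = no (λ not-pen → not-pen P penult≡P B≡P)
  ... | no B≢P  = yes (not-penult B≢P)

  straddled? : ∀ a → Dec (Straddled σ a)
  straddled? a with Any.any? (λ B → not-penult? B ×-dec ((2 ≤? ∣ B ∣) ×-dec straddles? B a)) σ
  ... | yes some = yes (let B , Bσ , conditions = L.find some in B , Bσ , conditions)
  ... | no none  = no λ { (B , Bσ , conditions) → none (L.lose Bσ conditions) }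

  unstraddled? : ∀ a → Dec (Unstraddled σ a)
  unstraddled? a = Any.any? (λ X → ⁅ a ⁆ ≟S X) σ ×-dec ¬? (straddled? a)

  straddled-by : ∀ {a X} → X L.∈ σ → X ≢ P → Straddles X a → Straddled σ a
  straddled-by Xσ X≢P st = _ , Xσ , not-penult X≢P , straddles⇒big st , st

  P-straddles-unstraddled : ∀ {b} → Unstraddled σ b → Straddles P b
  P-straddles-unstraddled (bσ , not-straddled) with straddler bσ
  ... | X , Xσ , st with X ≟S P
  ... | yes refl = st
  ... | no X≢P   = ⊥-elim (not-straddled (straddled-by Xσ X≢P st))

  -- Undoing the tweak at the largest unstraddled singleton {a}: P straddles a,
  -- and moving the elements of P below a into {a} gives τ ∈ 𝓑 with T τ = σ.
  module UntweakAt (a : Fin (suc n)) (a-unstraddled : Unstraddled σ a)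
                   (larger : ∀ y → toℕ a < toℕ y → toℕ y < suc n → ¬ Unstraddled σ y) where
    aσ : ⁅ a ⁆ L.∈ σ
    aσ = proj₁ a-unstraddled

    P-straddles-a : Straddles P a
    P-straddles-a = P-straddles-unstraddled a-unstraddled

    x₁ y₁ : Fin (suc n)
    x₁ = proj₁ (proj₁ P-straddles-a)
    y₁ = proj₁ (proj₂ P-straddles-a)

    x₁∈P : x₁ ∈ P
    x₁∈P = proj₁ (proj₂ (proj₁ P-straddles-a))

    x₁<a : toℕ x₁ < toℕ a
    x₁<a = proj₂ (proj₂ (proj₁ P-straddles-a))

    y₁∈P : y₁ ∈ P
    y₁∈P = proj₁ (proj₂ (proj₂ P-straddles-a))

    a<y₁ : toℕ a < toℕ y₁
    a<y₁ = proj₂ (proj₂ (proj₂ P-straddles-a))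

    P≢⁅a⁆ : P ≢ ⁅ a ⁆
    P≢⁅a⁆ P≡⁅a⁆ = singleton-not-straddling (subst (λ W → Straddles W a) P≡⁅a⁆ P-straddles-a)

    a<n : toℕ a < n
    a<n = <-≤-trans a<y₁ (≤top y₁)

    M′ : Subset (suc n)
    M′ = P ∩ seg (toℕ a)

    M′⊆P : M′ ⊆ P
    M′⊆P h = proj₁ (x∈p∩q⁻ P _ h)

    M′<a : ∀ {m} → m ∈ M′ → toℕ m < toℕ a
    M′<a h = seg⁻ (toℕ a) (proj₂ (x∈p∩q⁻ P _ h))

    max-P∉M′ : ∀ m → IsMax P m → m ∉ M′
    max-P∉M′ m (_ , m-max) h = <-irrefl refl (<-trans (M′<a h) (<-≤-trans a<y₁ (m-max y₁ y₁∈P)))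

    M′≤a : ∀ c m → IsMax ⁅ a ⁆ c → m ∈ M′ → toℕ m ≤ toℕ c
    M′≤a c m (c∈⁅a⁆ , _) h = subst (λ t → toℕ m ≤ toℕ t) (sym (∈⁅⁆ c∈⁅a⁆)) (<⇒≤ (M′<a h))

    open Move isP P ⁅ a ⁆ M′ Pπ aσ P≢⁅a⁆ M′⊆P max-P∉M′ M′≤a

    L′ P′ : Subset (suc n)
    L′ = g ⁅ a ⁆
    P′ = g P

    a∈L′ : a ∈ L′
    a∈L′ = ∈gC⁺ (inj₁ (x∈⁅x⁆ a))

    x₁∈M′ : x₁ ∈ M′
    x₁∈M′ = x∈p∩q⁺ (x₁∈P , seg⁺ (toℕ a) x₁<a)

    P′-above-a : ∀ {x} → x ∈ P′ → toℕ a < toℕ x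
    P′-above-a h with ∈gA⁻ h
    ... | xP , x∉M′ = ≤∧≢⇒< (≮⇒≥ λ x<a → x∉M′ (x∈p∩q⁺ (xP , seg⁺ (toℕ a) x<a)))
                             (λ { refl → P≢⁅a⁆ (same-block Pπ aσ xP (x∈⁅x⁆ _)) })

    stays-in-P′ : ∀ {x} → x ∈ P → toℕ a < toℕ x → x ∈ P′
    stays-in-P′ xP a<x = ∈-move⁺-stay M′ ⁅ a ⁆ P xP (λ h → <-irrefl refl (<-trans (M′<a h) a<x))

    penult-τ : penult τ ≡ just P′
    penult-τ = trans (penult-map g σ) (cong (Maybe.map g) penult≡P)

    not-new-penult : ∀ {B} → B ≢ P′ → ∀ Q → penult τ ≡ just Q → B ≢ Q
    not-new-penult B≢P′ Q pen-Q B≡Q = B≢P′ (trans B≡Q (just-injective (trans (sym pen-Q) penult-τ)))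

    gZ≡Z : g Z ≡ Z
    gZ≡Z = g-other Zπ (P≢Z ∘ sym) Z≢⁅a⁆
      where
      Z≢⁅a⁆ : Z ≢ ⁅ a ⁆
      Z≢⁅a⁆ Z≡⁅a⁆ = <-irrefl (trans (cong toℕ (sym (∈⁅⁆ (subst (fromℕ n ∈_) Z≡⁅a⁆ top∈Z)))) (toℕ-fromℕ n)) a<n

    Zτ : Z L.∈ τ
    Zτ = subst (L._∈ τ) gZ≡Z (∈-map⁺ g Zπ)

    L′τ : L′ L.∈ τ
    L′τ = ∈-map⁺ g aσ

    -- Condition (i): the last block of τ is still Z.
    τ-last-not-consecutive : ∀ B → B L.∈ τ → fromℕ n ∈ B → ¬ Consecutive B
    τ-last-not-consecutive B Bτ top∈B with ∈τ⁻ Bτ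
    ... | X , Xσ , refl with ∈-move⁻ M′ ⁅ a ⁆ X top∈B
    ...   | inj₂ (_ , top∈M′) = ⊥-elim (<-irrefl refl (<-trans (subst (_< toℕ a) (toℕ-fromℕ n) (M′<a top∈M′)) a<n))
    ...   | inj₁ (top∈X , _) with same-block Xσ Zπ top∈X top∈Z
    ...     | refl = Z-not-consecutive ∘ subst Consecutive gZ≡Z

    -- A singleton {b} = P′ is straddled by Z: Z has an element below b, as
    -- otherwise [b+1] would split σ (P′ = {b} makes b the largest element of P).
    remnant-straddled : ∀ {b} → ⁅ b ⁆ ≡ P′ → Straddled τ b
    remnant-straddled {b} ⁅b⁆≡P′ =
      Z , Zτ , not-new-penult Z≢P′ , straddles⇒big Z-straddles , Z-straddles
      where
      b∈P′ : b ∈ P′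
      b∈P′ = subst (b ∈_) ⁅b⁆≡P′ (x∈⁅x⁆ b)
      b∈P : b ∈ P
      b∈P = proj₁ (∈gA⁻ b∈P′)
      b<top : toℕ b < toℕ (fromℕ n)
      b<top = subst (toℕ b <_) (sym (toℕ-fromℕ n)) (P-below-top b∈P)
      P≤b : ∀ x → x ∈ P → toℕ x ≤ toℕ b
      P≤b x xP = ≮⇒≥ λ b<x →
        <-irrefl (cong toℕ (sym (∈⁅⁆ (subst (x ∈_) (sym ⁅b⁆≡P′) (stays-in-P′ xP (<-trans (P′-above-a b∈P′) b<x)))))) b<x
      Z≢P′ : Z ≢ P′
      Z≢P′ Z≡P′ = disjoint-blocks Pπ Zπ P≢Z (proj₁ (∈gA⁻ (subst (fromℕ n ∈_) Z≡P′ top∈Z))) top∈Z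
      Z-below-b : Σ (Fin (suc n)) λ z → z ∈ Z × toℕ z < toℕ b
      Z-below-b with FP.any? (λ z → (z ∈? Z) ×-dec (toℕ z <? toℕ b))
      ... | yes found = found
      ... | no none   = ⊥-elim (indecomposable (suc (toℕ b) , s≤s z≤n , s≤s (P-below-top b∈P) ,
                          split⇒union (suc (toℕ b)) (λ xP → seg⁺ (suc (toℕ b)) (s≤s (P≤b _ xP))) Z-above))
        where
        Z-above : Empty (Z ∩ seg (suc (toℕ b)))
        Z-above (z , h) with x∈p∩q⁻ Z _ h
        ... | zZ , z≤b with z FP.≟ b
        ...   | yes refl = disjoint-blocks Pπ Zπ P≢Z b∈P zZ
        ...   | no z≢b   = none (z , zZ , ≤∧≢⇒< (NP.≤-pred (seg⁻ (suc (toℕ b)) z≤b)) z≢b)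
      Z-straddles : Straddles Z b
      Z-straddles = Z-below-b , (fromℕ n , top∈Z , b<top)

    -- An unstraddled singleton {b} of σ below a becomes straddled by L′, which
    -- received the element of P below b.
    L′-straddles-below : ∀ {b} → Unstraddled σ b → toℕ b < toℕ a → Straddled τ b
    L′-straddles-below {b} b-unstraddled b<a =
      L′ , L′τ , not-new-penult L′≢P′ , straddles⇒big L′-straddles , L′-straddles
      where
      below-b : Σ (Fin (suc n)) λ x → x ∈ P × toℕ x < toℕ b
      below-b = proj₁ (P-straddles-unstraddled b-unstraddled)
      x₂ : Fin (suc n)
      x₂ = proj₁ below-b
      x₂<b : toℕ x₂ < toℕ b
      x₂<b = proj₂ (proj₂ below-b)
      x₂∈L′ : x₂ ∈ L′
      x₂∈L′ = ∈gC⁺ (inj₂ (x∈p∩q⁺ (proj₁ (proj₂ below-b) , seg⁺ (toℕ a) (<-trans x₂<b b<a))))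
      L′-straddles : Straddles L′ b
      L′-straddles = (x₂ , x₂∈L′ , x₂<b) , (a , a∈L′ , b<a)
      L′≢P′ : L′ ≢ P′
      L′≢P′ L′≡P′ = <-irrefl refl (P′-above-a (subst (a ∈_) L′≡P′ a∈L′))

    old-singleton-straddled : ∀ {b} → ⁅ b ⁆ L.∈ σ → b ≢ a → Straddled τ b
    old-singleton-straddled {b} bσ b≢a with straddled? b
    ... | yes (B , Bσ , B-not-pen , big , straddles) = B , Bτ , not-new-penult B≢P′ , big , straddles
      where
      B≢P : B ≢ P
      B≢P = B-not-pen P penult≡P
      B≢⁅a⁆ : B ≢ ⁅ a ⁆
      B≢⁅a⁆ refl = singleton-not-straddling straddles
      Bτ : B L.∈ τ
      Bτ = subst (L._∈ τ) (g-other Bσ B≢P B≢⁅a⁆) (∈-map⁺ g Bσ)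
      B≢P′ : B ≢ P′
      B≢P′ B≡P′ = disjoint-blocks Bσ Pπ B≢P (subst (y₁ ∈_) (sym B≡P′) (stays-in-P′ y₁∈P a<y₁)) y₁∈P
    ... | no not-straddled with FP.<-cmp b a
    ...   | tri< b<a _ _   = L′-straddles-below (bσ , not-straddled) b<a
    ...   | tri≈ _ b≡a _   = ⊥-elim (b≢a b≡a)
    ...   | tri> _ _ a<b   = ⊥-elim (larger b a<b (toℕ<n b) (bσ , not-straddled))

    τ-all-straddled : ∀ b → ⁅ b ⁆ L.∈ τ → Straddled τ b
    τ-all-straddled b bτ with ∈τ⁻ bτ
    ... | X , Xσ , ⁅b⁆≡gX with X ≟S ⁅ a ⁆ | X ≟S P
    ... | yes refl | _ = ⊥-elim (<-irrefl (cong toℕ (trans (in-⁅b⁆ (∈gC⁺ (inj₂ x₁∈M′))) (sym (in-⁅b⁆ a∈L′)))) x₁<a)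
      where
      in-⁅b⁆ : ∀ {x} → x ∈ L′ → x ≡ b
      in-⁅b⁆ h = ∈⁅⁆ (subst (_ ∈_) (sym ⁅b⁆≡gX) h)
    ... | no _    | yes refl = remnant-straddled ⁅b⁆≡gX
    ... | no X≢⁅a⁆ | no X≢P with sym (trans ⁅b⁆≡gX (g-other Xσ X≢P X≢⁅a⁆))
    ...   | refl = old-singleton-straddled Xσ λ { refl → X≢⁅a⁆ refl }

    -- [a+1] splits τ: L′ lies below a+1, P′ above a, and the other blocks do not
    -- straddle the unstraddled singleton a.
    τ-splits-at-a : UnionOfBlocks (suc (toℕ a)) τ
    τ-splits-at-a = All.tabulate λ Yτ → side (∈τ⁻ Yτ)
      where
      side : ∀ {Y} → Σ (Subset (suc n)) (λ X → X L.∈ σ × Y ≡ g X) → Y ⊆ seg (suc (toℕ a)) ⊎ Empty (Y ∩ seg (suc (toℕ a)))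
      side (X , Xσ , refl) with X ≟S ⁅ a ⁆ | X ≟S P
      ... | yes refl | _ = inj₁ λ xL′ → seg⁺ (suc (toℕ a)) (s≤s (L′-below xL′))
        where
        L′-below : ∀ {x} → x ∈ L′ → toℕ x ≤ toℕ a
        L′-below h with ∈gC⁻ h
        ... | inj₁ x∈⁅a⁆ = NP.≤-reflexive (cong toℕ (∈⁅⁆ x∈⁅a⁆))
        ... | inj₂ xM′   = <⇒≤ (M′<a xM′)
      ... | no _ | yes refl = inj₂ λ { (x , h) → let xP′ , x≤a = x∈p∩q⁻ P′ _ h in
                                       <-irrefl refl (<-≤-trans (P′-above-a xP′) (NP.≤-pred (seg⁻ (suc (toℕ a)) x≤a))) }
      ... | no X≢⁅a⁆ | no X≢P =
        subst (λ W → W ⊆ seg (suc (toℕ a)) ⊎ Empty (W ∩ seg (suc (toℕ a)))) (sym (g-other Xσ X≢P X≢⁅a⁆))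
          (side-of-singleton aσ Xσ (λ st → proj₂ a-unstraddled (straddled-by Xσ X≢P st)))

    τ-no-earlier-split : ∀ k → 1 ≤ k → k ≤ toℕ a → ¬ UnionOfBlocks k τ
    τ-no-earlier-split k 1≤k k≤a u = indecomposable (k , 1≤k , s≤s (≤-trans k≤a (<⇒≤ a<n)) , All.tabulate side)
      where
      L′-above : Empty (L′ ∩ seg k)
      L′-above with All.lookup u L′τ
      ... | inj₂ em  = em
      ... | inj₁ L′⊆ = λ _ → <-irrefl refl (<-≤-trans (seg⁻ k (L′⊆ a∈L′)) k≤a)
      side : ∀ {X} → X L.∈ σ → X ⊆ seg k ⊎ Empty (X ∩ seg k)
      side {X} Xσ with X ≟S ⁅ a ⁆ | X ≟S P
      ... | yes refl | _ = inj₂ λ { (x , h) → let x∈⁅a⁆ , x<k = x∈p∩q⁻ ⁅ a ⁆ _ h in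
                                    <-irrefl refl (<-≤-trans (subst (λ t → toℕ t < k) (∈⁅⁆ x∈⁅a⁆) (seg⁻ k x<k)) k≤a) }
      ... | no _ | yes refl = inj₂ λ { (x , h) → let xP , x<k = x∈p∩q⁻ P _ h in
              L′-above (x , x∈p∩q⁺ (∈gC⁺ (inj₂ (x∈p∩q⁺ (xP , seg⁺ (toℕ a) (<-≤-trans (seg⁻ k x<k) k≤a)))) , x<k)) }
      ... | no X≢⁅a⁆ | no X≢P =
        subst (λ W → W ⊆ seg k ⊎ Empty (W ∩ seg k)) (g-other Xσ X≢P X≢⁅a⁆) (All.lookup u (∈-map⁺ g Xσ))

    first-component : FirstComponent τ
    first-component = record { a₀ = a ; a₀<n = a<n ; splits = τ-splits-at-a ; least = τ-no-earlier-split }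

    L′-minus-a≡M′ : L′ - a ≡ M′
    L′-minus-a≡M′ = ⊆-antisym to (λ xM′ → ∈-minus⁺ (∈gC⁺ (inj₂ xM′)) (λ { refl → <-irrefl refl (M′<a xM′) }))
      where
      to : L′ - a ⊆ M′
      to h with ∈-minus⁻ h
      ... | xL′ , x≢a with ∈gC⁻ xL′
      ...   | inj₁ x∈⁅a⁆ = ⊥-elim (x≢a (∈⁅⁆ x∈⁅a⁆))
      ...   | inj₂ xM′   = xM′

    T-τ : T τ ≡ σ
    T-τ = begin
      T τ                      ≡⟨ T≡move penult-τ ⟩
      map (move (L′ - a) P′) τ ≡⟨ cong (λ W → map (move W P′) τ) L′-minus-a≡M′ ⟩
      map (move M′ (g P)) τ    ≡⟨ move-back ⟩
      σ                        ∎
      where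
      open TweakFormula moved-partition first-component L′τ a∈L′ using (T≡move)
      open ≡-Reasoning

    preimage : Σ (List (Subset (suc n))) λ π → InB n π × T π ≡ σ
    preimage = τ , (moved-partition , τ-last-not-consecutive , τ-all-straddled) , T-τ

  preimage : Σ (List (Subset (suc n))) λ π → InB n π × T π ≡ σ
  preimage with largest (Unstraddled σ) unstraddled? (suc n) ≤-refl
  ... | inj₂ (a , a-unstraddled , larger) = UntweakAt.preimage a a-unstraddled larger
  ... | inj₁ none = σ , (isP , last-not-consecutive , all-straddled) , T-fixed
    where
    last-not-consecutive : ∀ B → B L.∈ σ → fromℕ n ∈ B → ¬ Consecutive B
    last-not-consecutive B Bσ top∈B with same-block Bσ Zπ top∈B top∈Z
    ... | refl = Z-not-consecutive
    all-straddled : ∀ a → ⁅ a ⁆ L.∈ σ → Straddled σ a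
    all-straddled a aσ with straddled? a
    ... | yes straddled = straddled
    ... | no not-straddled = ⊥-elim (none a (toℕ<n a) (aσ , not-straddled))
    T-fixed : T σ ≡ σ
    T-fixed with T-cases σ
    ... | inj₁ (_ , T≡) = T≡
    ... | inj₂ fc = ⊥-elim (indecomposable (FirstComponent.decomposable fc))

-- A member of 𝓑 has at least two blocks, since a single block [n+1] would be
-- consecutive.
InB⇒two-blocks : ∀ {n} {π : List (Subset (suc n))} → InB n π → 2 ≤ length π
InB⇒two-blocks {n} {[]} (isP , _) with IsSetPartition.covers isP (fromℕ n)
... | ()
InB⇒two-blocks {n} {X ∷ []} (isP , last-not-consecutive , _) =
  ⊥-elim (last-not-consecutive X (here refl) (in-X (fromℕ n)) (λ _ _ x _ _ _ _ → in-X x))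
  where
  in-X : ∀ x → x ∈ X
  in-X x with IsSetPartition.covers isP x
  ... | here x∈X = x∈X
InB⇒two-blocks {π = _ ∷ _ ∷ _} _ = s≤s (s≤s z≤n)

T-into-IP* : ∀ n (π : List (Subset (suc n))) → InB n π → InIPstar n (T π)
T-into-IP* n π hB with T-cases π
... | inj₁ (indecomposable , T≡π) = subst (InIPstar n) (sym T≡π) (proj₁ hB , indecomposable , InB⇒two-blocks hB)
... | inj₂ fc                     = TweakOnB.T∈IP* hB fc

-- A fixed point of T in 𝓑 has only straddled singletons, while the tweak of a
-- decomposable member of 𝓑 has the unstraddled singleton {a₀}.
fixed-vs-tweaked : ∀ {n} {π σ : List (Subset (suc n))} → InB n π → T π ≡ π → (hσ : InB n σ) → FirstComponent σ →
                   T π ≢ T σ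
fixed-vs-tweaked {n} hπ T≡π hσ fσ eq with TweakOnB.a₀-unstraddled-in-T hσ fσ
... | a₀∈Tσ , a₀-not-straddled =
  a₀-not-straddled (subst (λ ρ → ∀ a → ⁅ a ⁆ L.∈ ρ → Straddled ρ a) (trans (sym T≡π) eq) (proj₂ (proj₂ hπ)) _ a₀∈Tσ)

-- The tweak point is determined by the image: a₀ is the largest unstraddled
-- singleton of T π.
tweak-point-≮ : ∀ {n} {π σ : List (Subset (suc n))} (hπ : InB n π) (fπ : FirstComponent π)
                (hσ : InB n σ) (fσ : FirstComponent σ) → T π ≡ T σ →
                ¬ (toℕ (FirstComponent.a₀ fπ) < toℕ (FirstComponent.a₀ fσ))
tweak-point-≮ hπ fπ hσ fσ eq a₁<a₂ with TweakOnB.a₀-unstraddled-in-T hσ fσ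
... | a₂∈Tσ , a₂-not-straddled =
  a₂-not-straddled (subst (λ ρ → Straddled ρ _) eq
    (TweakOnB.above-a₀-straddled-in-T hπ fπ _ (subst (⁅ _ ⁆ L.∈_) (sym eq) a₂∈Tσ) a₁<a₂))

same-tweak-point : ∀ {n} {π σ : List (Subset (suc n))} (hπ : InB n π) (fπ : FirstComponent π)
                   (hσ : InB n σ) (fσ : FirstComponent σ) → T π ≡ T σ →
                   FirstComponent.a₀ fπ ≡ FirstComponent.a₀ fσ
same-tweak-point hπ fπ hσ fσ eq with FP.<-cmp (FirstComponent.a₀ fπ) (FirstComponent.a₀ fσ)
... | tri< a₁<a₂ _ _ = ⊥-elim (tweak-point-≮ hπ fπ hσ fσ eq a₁<a₂)
... | tri≈ _ a₁≡a₂ _ = a₁≡a₂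
... | tri> _ _ a₂<a₁ = ⊥-elim (tweak-point-≮ hσ fσ hπ fπ (sym eq) a₂<a₁)

T-injective : ∀ n (π σ : List (Subset (suc n))) → InB n π → InB n σ → T π ≡ T σ → π ≡ σ
T-injective n π σ hπ hσ eq with T-cases π | T-cases σ
... | inj₁ (_ , T≡π) | inj₁ (_ , T≡σ) = trans (sym T≡π) (trans eq T≡σ)
... | inj₁ (_ , T≡π) | inj₂ fσ        = ⊥-elim (fixed-vs-tweaked hπ T≡π hσ fσ eq)
... | inj₂ fπ        | inj₁ (_ , T≡σ) = ⊥-elim (fixed-vs-tweaked hσ T≡σ hπ fπ (sym eq))
... | inj₂ fπ        | inj₂ fσ        = begin
  π                                    ≡⟨ sym (TweakOnB.untweak-T hπ fπ) ⟩
  untweak (FirstComponent.a₀ fπ) (T π) ≡⟨ cong₂ untweak (same-tweak-point hπ fπ hσ fσ eq) eq ⟩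
  untweak (FirstComponent.a₀ fσ) (T σ) ≡⟨ TweakOnB.untweak-T hσ fσ ⟩
  σ                                    ∎
  where open ≡-Reasoning

proposition5 : (n : ℕ) → 1 ≤ n →
    (∀ (π : List (Subset (suc n))) → InB n π → InIPstar n (T π))
    × (∀ (π σ : List (Subset (suc n))) → InB n π → InB n σ → T π ≡ T σ → π ≡ σ)
    × (∀ (σ : List (Subset (suc n))) → InIPstar n σ → Σ (List (Subset (suc n))) λ π → InB n π × T π ≡ σ)
proposition5 n 1≤n = T-into-IP* n , T-injective n , λ σ σ∈IP* → SingletonsOfIP*.preimage 1≤n σ∈IP*
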